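{- Let $t \in \mathbb{N}$ and let $n \ge 4t+6$ be an integer with $n \equiv 2 \pmod 4$. Let \[ \mathcal{S}''_{t,n} = \{1, 2, \ldots, t-1\} \cup \left\{\tfrac{n+2}{4}, \tfrac{n+6}{4}\right\} \cup \left\{\tfrac{n}{2}-(t-1), \ldots, \tfrac{n}{2}-2, \tfrac{n}{2}-1\right\} \] (for $t=1$ the first and last sets are empty). Then the circulant graph $\mathrm{Circ}(n, \mathcal{S}''_{t,n})$ is a $4t$-regular nut graph of order $n$.
   Context: All graphs are finite, simple and undirected, with vertex set $\{0,1,\ldots,n-1\}$. For $S \subseteq \{1, 2, \ldots, \lfloor n/2 \rfloor\}$, the circulant graph $\mathrm{Circ}(n,S)$ is the graph on $\{0,\ldots,n-1\}$ in which distinct vertices $u,v$ are adjacent iff $(u-v) \bmod n \in S$ or $(v-u) \bmod n \in S$. A nut graph is a graph with at least two vertices whose adjacency matrix has nullity exactly one and whose non-zero null-space vectors have no zero entries. -}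

module Defs where

open import Data.Nat as ℕ using (ℕ; zero; suc; _≤_; _<_; _∸_; _%_; _/_)
import Data.Nat.Properties as ℕP
open import Data.Fin using (Fin; toℕ)
open import Data.List using (List; length; filter; foldr; map)
open import Data.List.Base using (allFin)
open import Data.Rational as ℚ using (ℚ; 0ℚ; 1ℚ)
open import Data.Sum using (_⊎_)
open import Data.Product using (_×_; ∃; ∃-syntax; _,_)
open import Relation.Nullary using (¬_; Dec; yes; no)
open import Relation.Nullary.Decidable using (_⊎-dec_; _×-dec_; ¬?)
open import Relation.Binary.PropositionalEquality using (_≡_)
open import Relation.Unary using (Pred; Decidable)

record Graph (n : ℕ) : Set₁ where
  field
    Adj  : Fin n → Fin n → Set
    adj? : ∀ u v → Dec (Adj u v)

open Graph public

-- Circulant graph Circ(n,S), S a decidable set of naturals: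
-- u ~ v iff u ≠ v and ((u-v) mod n ∈ S or (v-u) mod n ∈ S).
-- (u - v) mod n is computed as (u + n - v) % n, which is correct for u,v < n.
diffMod : (n : ℕ) .{{_ : ℕ.NonZero n}} → Fin n → Fin n → ℕ
diffMod n u v = ((toℕ u ℕ.+ n) ∸ toℕ v) % n

Circ : (n : ℕ) .{{_ : ℕ.NonZero n}} (S : Pred ℕ _) → Decidable S → Graph n
Circ n S S? = record
  { Adj  = λ u v → ¬ (toℕ u ≡ toℕ v) × (S (diffMod n u v) ⊎ S (diffMod n v u))
  ; adj? = λ u v → ¬? (toℕ u ℕP.≟ toℕ v) ×-dec (S? (diffMod n u v) ⊎-dec S? (diffMod n v u))
  }

degree : ∀ {n} → Graph n → Fin n → ℕ
degree G u = length (filter (adj? G u) (allFin _))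

IsRegular : ∀ {n} → ℕ → Graph n → Set
IsRegular k G = ∀ u → degree G u ≡ k

-- adjacency matrix over ℚ (nullity over ℚ equals nullity over ℝ for an integer matrix)
adjMatrix : ∀ {n} → Graph n → Fin n → Fin n → ℚ
adjMatrix G u v with adj? G u v
... | yes _ = 1ℚ
... | no  _ = 0ℚ

∑ : ∀ {n} → (Fin n → ℚ) → ℚ
∑ f = foldr ℚ._+_ 0ℚ (map f (allFin _))

Vector : ℕ → Set
Vector n = Fin n → ℚ

InNullSpace : ∀ {n} → Graph n → Vector n → Set
InNullSpace G x = ∀ u → ∑ (λ v → adjMatrix G u v ℚ.* x v) ≡ 0ℚ

NonZeroVec : ∀ {n} → Vector n → Set
NonZeroVec x = ∃[ i ] ¬ (x i ≡ 0ℚ)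

NullityOne : ∀ {n} → Graph n → Set
NullityOne G = ∃[ x ] (InNullSpace G x × NonZeroVec x ×
                 (∀ y → InNullSpace G y → ∃[ c ] (∀ i → y i ≡ c ℚ.* x i)))

IsNut : ∀ {n} → Graph n → Set
IsNut {n} G = 2 ≤ n × NullityOne G ×
  (∀ y → InNullSpace G y → NonZeroVec y → ∀ i → ¬ (y i ≡ 0ℚ))

S'' : ℕ → ℕ → Pred ℕ _
S'' t n d = (1 ≤ d × d ≤ t ∸ 1)
          ⊎ (d ≡ (n ℕ.+ 2) / 4)
          ⊎ (d ≡ (n ℕ.+ 6) / 4)
          ⊎ ((n / 2) ∸ (t ∸ 1) ≤ d × d ≤ (n / 2) ∸ 1)

S''? : ∀ t n → Decidable (S'' t n)
S''? t n d = ((1 ℕP.≤? d) ×-dec (d ℕP.≤? t ∸ 1))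
        ⊎-dec ((d ℕP.≟ (n ℕ.+ 2) / 4)
        ⊎-dec ((d ℕP.≟ (n ℕ.+ 6) / 4)
        ⊎-dec (((n / 2) ∸ (t ∸ 1) ℕP.≤? d) ×-dec (d ℕP.≤? (n / 2) ∸ 1))))

module Submission where

-- Write n = 2h, so h = n/2 is odd, and m = (n+2)/4, so h = 2m - 1. On n-periodic integer vectors the
-- adjacency operator is (Ay)_a = Σ_{d∈S} (y_{a+d} + y_{a-d}). The map d ↦ h - d exchanges the blocks
-- {1,…,t-1} and {h-t+1,…,h-1} of S and sends m, m+1 to m-1, m-2; hence when y_{x+h} = ±y_x the two
-- blocks contribute equal or opposite amounts and only the window y_{a+m-2},…,y_{a+m+1} remains.
-- For a kernel vector y, the h-periodic vector y_x + y_{x+h} then has even windows, so it is constant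
-- mod 2 (h is odd); it also sums to 0 over a period, so it is even, and halving it repeatedly shows
-- that it vanishes. Thus y is h-antiperiodic, its pair sums y_v + y_{v+1} are 2-periodic and change
-- sign under v ↦ v + 1, and y_{v+2k} = y_v - 2k(y_v + y_{v+1}); n-periodicity forces the pair sums to
-- vanish, i.e. y_v = (-1)^v y_0. Rational kernel vectors reduce to integer ones by clearing
-- denominators, and the all-ones vector gives the degree 2|S| = 4t.

open import Data.Bool using (true; false; if_then_else_)
open import Data.Nat as ℕ using (ℕ; zero; suc; _∸_; _%_; _/_; _<_; _≤_; z≤n; s≤s; z<s; s<s; NonZero)
import Data.Nat.Properties as ℕ
open import Data.Nat.DivMod using (m<n⇒m%n≡m; [m+n]%n≡m%n; m%n<n; m≡m%n+[m/n]*n; m*n/n≡m)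
open import Data.Nat.Induction using (<-rec)
open import Data.Integer as ℤ using (ℤ; +_; +[1+_]; 0ℤ; 1ℤ; -1ℤ; ∣_∣; _^_)
import Data.Integer.Properties as ℤ
open import Data.Integer.Divisibility.Signed
  using (_∣_; divides; ∣m∣n⇒∣m+n; ∣m∣n⇒∣m-n; ∣m⇒∣-m; ∣m+n∣m⇒∣n; ∣m+n∣n⇒∣m)
open import Data.Fin as Fin using (Fin; toℕ; fromℕ<)
import Data.Fin.Properties as Fin
open import Data.Rational as ℚ using (ℚ; 0ℚ; 1ℚ; ↥_; ↧_; mkℚ)
open import Data.Rational.Literals using (fromℤ)
import Data.Rational.Properties as ℚ
open import Data.Rational.Unnormalised using (*≡*)
import Data.Rational.Unnormalised.Properties as ℚᵘ
open import Data.List using ([]; _∷_; length; filter; foldr; map; allFin)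
import Data.List.Properties as List
open import Data.Product using (_×_; _,_; proj₁; proj₂; ∃-syntax; Σ-syntax)
open import Data.Sum using (_⊎_; inj₁; inj₂)
open import Function using (_∘_; id)
open import Level using (0ℓ)
open import Relation.Nullary using (¬_; Dec; does; yes; no; contradiction)
open import Relation.Nullary.Decidable using (_⊎-dec_; _×-dec_; ¬?)
open import Relation.Unary using (Pred; Decidable)
open import Relation.Binary.PropositionalEquality
open import Data.Nat.Tactic.RingSolver using (solve-∀)
open import Data.Integer.Tactic.RingSolver renaming (solve-∀ to ℤsolve-∀)
open import Defs

Periodic : ℕ → (ℕ → ℤ) → Set
Periodic p f = ∀ x → f (p ℕ.+ x) ≡ f x

module IntegerSums where

  open import Data.Integer using (_+_; _*_)

  sum : ℕ → (ℕ → ℤ) → ℤ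
  sum zero    f = 0ℤ
  sum (suc k) f = f 0 + sum k (f ∘ suc)

  sum-cong : ∀ k {f g : ℕ → ℤ} → (∀ i → i < k → f i ≡ g i) → sum k f ≡ sum k g
  sum-cong zero    f≡g = refl
  sum-cong (suc k) f≡g = cong₂ _+_ (f≡g 0 z<s) (sum-cong k (λ i i<k → f≡g (suc i) (s<s i<k)))

  sum-distrib-+ : ∀ k (f g : ℕ → ℤ) → sum k (λ i → f i + g i) ≡ sum k f + sum k g
  sum-distrib-+ zero    f g = refl
  sum-distrib-+ (suc k) f g = trans (cong (_+_ (f 0 + g 0)) (sum-distrib-+ k (f ∘ suc) (g ∘ suc)))
                                    (interchange (f 0) (g 0) (sum k (f ∘ suc)) (sum k (g ∘ suc)))
    where
    interchange : ∀ a b c d → (a + b) + (c + d) ≡ (a + c) + (b + d)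
    interchange = ℤsolve-∀

  sum-distribˡ-* : ∀ k c (f : ℕ → ℤ) → sum k (λ i → c * f i) ≡ c * sum k f
  sum-distribˡ-* zero    c f = sym (ℤ.*-zeroʳ c)
  sum-distribˡ-* (suc k) c f =
    trans (cong (_+_ (c * f 0)) (sum-distribˡ-* k c (f ∘ suc))) (sym (ℤ.*-distribˡ-+ c (f 0) (sum k (f ∘ suc))))

  sum-const : ∀ k c → sum k (λ _ → c) ≡ + k * c
  sum-const zero    c = sym (ℤ.*-zeroˡ c)
  sum-const (suc k) c = trans (cong (_+_ c) (sum-const k c)) (sym (ℤ.suc-* (+ k) c))

  sum-zero : ∀ k {f : ℕ → ℤ} → (∀ i → i < k → f i ≡ 0ℤ) → sum k f ≡ 0ℤ
  sum-zero k f≡0 = trans (sum-cong k f≡0) (trans (sum-const k 0ℤ) (ℤ.*-zeroʳ (+ k)))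

  sum-++ : ∀ k l (f : ℕ → ℤ) → sum (k ℕ.+ l) f ≡ sum k f + sum l (λ i → f (k ℕ.+ i))
  sum-++ zero    l f = sym (ℤ.+-identityˡ _)
  sum-++ (suc k) l f = trans (cong (_+_ (f 0)) (sum-++ k l (f ∘ suc))) (sym (ℤ.+-assoc (f 0) _ _))

  sum-snoc : ∀ k (f : ℕ → ℤ) → sum (suc k) f ≡ sum k f + f k
  sum-snoc k f = begin
    sum (suc k) f                  ≡⟨ cong (λ l → sum l f) (ℕ.+-comm 1 k) ⟩
    sum (k ℕ.+ 1) f                ≡⟨ sum-++ k 1 f ⟩
    sum k f + (f (k ℕ.+ 0) + 0ℤ)   ≡⟨ cong (_+_ (sum k f)) (ℤ.+-identityʳ _) ⟩
    sum k f + f (k ℕ.+ 0)          ≡⟨ cong (λ i → sum k f + f i) (ℕ.+-identityʳ k) ⟩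
    sum k f + f k                  ∎
    where open ≡-Reasoning

  sum-reverse : ∀ k (f : ℕ → ℤ) → sum k f ≡ sum k (λ i → f (k ∸ suc i))
  sum-reverse zero    f = refl
  sum-reverse (suc k) f = begin
    f 0 + sum k (f ∘ suc)                        ≡⟨ cong (_+_ (f 0)) (sum-reverse k (f ∘ suc)) ⟩
    f 0 + sum k (λ i → f (suc (k ∸ suc i)))      ≡⟨ cong (_+_ (f 0)) (sum-cong k (λ i i<k → cong f (sym (ℕ.+-∸-assoc 1 i<k)))) ⟩
    f 0 + sum k (λ i → f (suc k ∸ suc i))        ≡⟨ ℤ.+-comm (f 0) _ ⟩
    sum k (λ i → f (suc k ∸ suc i)) + f 0        ≡⟨ cong (λ j → sum k (λ i → f (suc k ∸ suc i)) + f j) (ℕ.n∸n≡0 k) ⟨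
    sum k (λ i → f (suc k ∸ suc i)) + f (k ∸ k)  ≡⟨ sum-snoc k (λ i → f (suc k ∸ suc i)) ⟨
    sum (suc k) (λ i → f (suc k ∸ suc i))        ∎
    where open ≡-Reasoning

  sum-rotate : ∀ k (f : ℕ → ℤ) → f k ≡ f 0 → sum k (f ∘ suc) ≡ sum k f
  sum-rotate zero    f _     = refl
  sum-rotate (suc k) f fk≡f0 = begin
    sum (suc k) (f ∘ suc)        ≡⟨ sum-snoc k (f ∘ suc) ⟩
    sum k (f ∘ suc) + f (suc k)  ≡⟨ cong (_+_ (sum k (f ∘ suc))) fk≡f0 ⟩
    sum k (f ∘ suc) + f 0        ≡⟨ ℤ.+-comm _ (f 0) ⟩
    sum (suc k) f                ∎
    where open ≡-Reasoning

  sum-reflect : ∀ k (f : ℕ → ℤ) → f k ≡ f 0 → sum k (λ j → f (k ∸ j)) ≡ sum k f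
  sum-reflect k f fk≡f0 = begin
    sum k (λ j → f (k ∸ j))       ≡⟨ sum-rotate k (λ j → f (k ∸ j)) (trans (cong f (ℕ.n∸n≡0 k)) (sym fk≡f0)) ⟨
    sum k (λ j → f (k ∸ suc j))   ≡⟨ sum-reverse k f ⟨
    sum k f                       ∎
    where open ≡-Reasoning

  sum-periodic : ∀ k (f : ℕ → ℤ) → Periodic k f → ∀ c → sum k (λ i → f (c ℕ.+ i)) ≡ sum k f
  sum-periodic k f per zero    = refl
  sum-periodic k f per (suc c) = begin
    sum k (λ i → f (suc c ℕ.+ i))  ≡⟨ sum-cong k (λ i _ → cong f (sym (ℕ.+-suc c i))) ⟩
    sum k (λ i → f (c ℕ.+ suc i))  ≡⟨ sum-rotate k (λ i → f (c ℕ.+ i)) f[c+k]≡f[c+0] ⟩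
    sum k (λ i → f (c ℕ.+ i))      ≡⟨ sum-periodic k f per c ⟩
    sum k f                        ∎
    where
    open ≡-Reasoning
    f[c+k]≡f[c+0] : f (c ℕ.+ k) ≡ f (c ℕ.+ 0)
    f[c+k]≡f[c+0] = trans (cong f (ℕ.+-comm c k)) (trans (per c) (cong f (sym (ℕ.+-identityʳ c))))

  sum-comm : ∀ k l (f : ℕ → ℕ → ℤ) → sum k (λ a → sum l (f a)) ≡ sum l (λ i → sum k (λ a → f a i))
  sum-comm zero    l f = sym (sum-zero l (λ _ _ → refl))
  sum-comm (suc k) l f = trans (cong (_+_ (sum l (f 0))) (sum-comm k l (f ∘ suc)))
                               (sym (sum-distrib-+ l (f 0) (λ i → sum k (λ a → f (suc a) i))))

  ∣-sum : ∀ {d} k (f : ℕ → ℤ) → (∀ i → i < k → d ∣ f i) → d ∣ sum k f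
  ∣-sum zero    f d∣f = divides 0ℤ refl
  ∣-sum (suc k) f d∣f = ∣m∣n⇒∣m+n (d∣f 0 z<s) (∣-sum k (f ∘ suc) (λ i i<k → d∣f (suc i) (s<s i<k)))

module Iteration where

  open import Data.Integer using (_+_; _*_; _-_)

  periodic-* : ∀ {p f} → Periodic p f → ∀ k x → f (k ℕ.* p ℕ.+ x) ≡ f x
  periodic-*         per zero    x = refl
  periodic-* {p} {f} per (suc k) x = trans (cong f (ℕ.+-assoc p (k ℕ.* p) x)) (trans (per (k ℕ.* p ℕ.+ x)) (periodic-* per k x))

  PeriodicMod : ℤ → ℕ → (ℕ → ℤ) → Set
  PeriodicMod d p f = ∀ x → d ∣ f (p ℕ.+ x) - f x

  periodicMod-* : ∀ {d p f} → PeriodicMod d p f → ∀ k x → d ∣ f (k ℕ.* p ℕ.+ x) - f x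
  periodicMod-* {d} {p} {f} per zero    x = subst (d ∣_) (sym (ℤ.+-inverseʳ (f x))) (divides 0ℤ refl)
  periodicMod-* {d} {p} {f} per (suc k) x =
    subst (d ∣_) telescope (∣m∣n⇒∣m+n (per (k ℕ.* p ℕ.+ x)) (periodicMod-* {f = f} per k x))
    where
    collapse : ∀ a b c → a - b + (b - c) ≡ a - c
    collapse = ℤsolve-∀
    telescope : f (p ℕ.+ (k ℕ.* p ℕ.+ x)) - f (k ℕ.* p ℕ.+ x) + (f (k ℕ.* p ℕ.+ x) - f x) ≡ f (p ℕ.+ k ℕ.* p ℕ.+ x) - f x
    telescope = trans (collapse (f (p ℕ.+ (k ℕ.* p ℕ.+ x))) (f (k ℕ.* p ℕ.+ x)) (f x))
                      (cong (λ y → f y - f x) (sym (ℕ.+-assoc p (k ℕ.* p) x)))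

  increment-* : ∀ (f e : ℕ → ℤ) p → (∀ x → f (p ℕ.+ x) ≡ f x + e x) → Periodic p e →
                ∀ k x → f (k ℕ.* p ℕ.+ x) ≡ f x + + k * e x
  increment-* f e p step e-per zero    x = sym (trans (cong (_+_ (f x)) (ℤ.*-zeroˡ (e x))) (ℤ.+-identityʳ (f x)))
  increment-* f e p step e-per (suc k) x = begin
    f (p ℕ.+ k ℕ.* p ℕ.+ x)                  ≡⟨ cong f (ℕ.+-assoc p (k ℕ.* p) x) ⟩
    f (p ℕ.+ (k ℕ.* p ℕ.+ x))                ≡⟨ step (k ℕ.* p ℕ.+ x) ⟩
    f (k ℕ.* p ℕ.+ x) + e (k ℕ.* p ℕ.+ x)    ≡⟨ cong₂ _+_ (increment-* f e p step e-per k x) (periodic-* e-per k x) ⟩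
    f x + + k * e x + e x                    ≡⟨ regroup (f x) (+ k) (e x) ⟩
    f x + + suc k * e x                      ∎
    where
    open ≡-Reasoning
    regroup : ∀ y k z → y + k * z + z ≡ y + (+ 1 + k) * z
    regroup = ℤsolve-∀

  infinite-descent : {X : Set} (Good : (X → ℤ) → Set) →
    (∀ {q} → Good q → ∀ x → + 2 ∣ q x) →
    (∀ {q q′} → (∀ x → q x ≡ q′ x * + 2) → Good q → Good q′) →
    ∀ {q} → Good q → ∀ x → q x ≡ 0ℤ
  infinite-descent {X} Good even halve {q} good x = <-rec Goal step ∣ q x ∣ q good refl
    where
    Goal : ℕ → Set
    Goal n = ∀ q → Good q → ∣ q x ∣ ≡ n → q x ≡ 0ℤ
    step : ∀ n → (∀ {m} → m < n → Goal m) → Goal n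
    step n smaller q good refl with ∣ q x ∣ ℕ.≟ 0
    ... | yes ∣qx∣≡0 = ℤ.∣i∣≡0⇒i≡0 ∣qx∣≡0
    ... | no  ∣qx∣≢0 = trans (q≡q′*2 x) (cong (_* + 2) (smaller ∣q′x∣<∣qx∣ q′ (halve q≡q′*2 good) refl))
      where
      q′ : X → ℤ
      q′ y = _∣_.quotient (even good y)
      q≡q′*2 : ∀ y → q y ≡ q′ y * + 2
      q≡q′*2 y = _∣_.equality (even good y)
      ∣qx∣≡∣q′x∣*2 : ∣ q x ∣ ≡ ∣ q′ x ∣ ℕ.* 2
      ∣qx∣≡∣q′x∣*2 = trans (cong ∣_∣ (q≡q′*2 x)) (ℤ.abs-* (q′ x) (+ 2))
      instance
        q′x≢0 : NonZero ∣ q′ x ∣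
        q′x≢0 = ℕ.≢-nonZero (λ ∣q′x∣≡0 → ∣qx∣≢0 (trans ∣qx∣≡∣q′x∣*2 (cong (ℕ._* 2) ∣q′x∣≡0)))
      ∣q′x∣<∣qx∣ : ∣ q′ x ∣ < ∣ q x ∣
      ∣q′x∣<∣qx∣ = subst (∣ q′ x ∣ <_) (sym ∣qx∣≡∣q′x∣*2) (ℕ.m<m*n ∣ q′ x ∣ 2 (ℕ.n<1+n 1))

module Rationals where

  open IntegerSums using (sum)

  fromℤ-injective : ∀ {a b} → fromℤ a ≡ fromℤ b → a ≡ b
  fromℤ-injective = cong ↥_

  fromℤ-+ : ∀ a b → fromℤ (a ℤ.+ b) ≡ fromℤ a ℚ.+ fromℤ b
  fromℤ-+ a b = ℚ.toℚᵘ-injective (ℚᵘ.≃-trans (*≡* (identity a b)) (ℚᵘ.≃-sym (ℚ.toℚᵘ-homo-+ (fromℤ a) (fromℤ b))))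
    where
    identity : ∀ a b → (a ℤ.+ b) ℤ.* + 1 ≡ (a ℤ.* + 1 ℤ.+ b ℤ.* + 1) ℤ.* + 1
    identity = ℤsolve-∀

  fromℤ-* : ∀ a b → fromℤ (a ℤ.* b) ≡ fromℤ a ℚ.* fromℤ b
  fromℤ-* a b = ℚ.toℚᵘ-injective (ℚᵘ.≃-sym (ℚ.toℚᵘ-homo-* (fromℤ a) (fromℤ b)))

  fromℤ-↧-* : ∀ q → fromℤ (↧ q) ℚ.* q ≡ fromℤ (↥ q)
  fromℤ-↧-* q@(mkℚ n _ _) = ℚ.toℚᵘ-injective (ℚᵘ.≃-trans (ℚ.toℚᵘ-homo-* (fromℤ (↧ q)) q) (*≡* (identity (↧ q) n)))
    where
    identity : ∀ d n → (d ℤ.* n) ℤ.* + 1 ≡ n ℤ.* (+ 1 ℤ.* d)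
    identity = ℤsolve-∀

  *-cancelˡ-≡ : ∀ c {p q} .{{_ : ℚ.NonZero c}} → c ℚ.* p ≡ c ℚ.* q → p ≡ q
  *-cancelˡ-≡ c {p} {q} cp≡cq = begin
    p                    ≡⟨ ℚ.*-identityˡ p ⟨
    1ℚ ℚ.* p             ≡⟨ cong (ℚ._* p) (ℚ.*-inverseˡ c) ⟨
    ℚ.1/ c ℚ.* c ℚ.* p   ≡⟨ ℚ.*-assoc (ℚ.1/ c) c p ⟩
    ℚ.1/ c ℚ.* (c ℚ.* p) ≡⟨ cong (ℚ.1/ c ℚ.*_) cp≡cq ⟩
    ℚ.1/ c ℚ.* (c ℚ.* q) ≡⟨ ℚ.*-assoc (ℚ.1/ c) c q ⟨
    ℚ.1/ c ℚ.* c ℚ.* q   ≡⟨ cong (ℚ._* q) (ℚ.*-inverseˡ c) ⟩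
    1ℚ ℚ.* q             ≡⟨ ℚ.*-identityˡ q ⟩
    q                    ∎
    where open ≡-Reasoning

  ∑-cong : ∀ {n} {f g : Fin n → ℚ} → (∀ v → f v ≡ g v) → ∑ f ≡ ∑ g
  ∑-cong {n} f≗g = cong (foldr ℚ._+_ 0ℚ) (List.map-cong f≗g (allFin n))

  ∑-suc : ∀ {n} (f : Fin (suc n) → ℚ) → ∑ f ≡ f Fin.zero ℚ.+ ∑ (f ∘ Fin.suc)
  ∑-suc f = cong (λ xs → foldr ℚ._+_ 0ℚ (f Fin.zero ∷ xs))
    (trans (List.map-tabulate Fin.suc f) (sym (List.map-tabulate id (f ∘ Fin.suc))))

  ∑-fromℤ : ∀ n (F : ℕ → ℤ) → ∑ {n} (λ v → fromℤ (F (toℕ v))) ≡ fromℤ (sum n F)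
  ∑-fromℤ zero    F = refl
  ∑-fromℤ (suc n) F = begin
    ∑ {suc n} (λ v → fromℤ (F (toℕ v)))                    ≡⟨ ∑-suc {n} (λ v → fromℤ (F (toℕ v))) ⟩
    fromℤ (F 0) ℚ.+ ∑ {n} (λ v → fromℤ (F (suc (toℕ v))))  ≡⟨ cong (fromℤ (F 0) ℚ.+_) (∑-fromℤ n (F ∘ suc)) ⟩
    fromℤ (F 0) ℚ.+ fromℤ (sum n (F ∘ suc))                ≡⟨ fromℤ-+ (F 0) (sum n (F ∘ suc)) ⟨
    fromℤ (sum (suc n) F)                                  ∎
    where open ≡-Reasoning

  ∑-distribˡ-* : ∀ {n} c (f : Fin n → ℚ) → ∑ (λ v → c ℚ.* f v) ≡ c ℚ.* ∑ f
  ∑-distribˡ-* {zero}  c f = sym (ℚ.*-zeroʳ c)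
  ∑-distribˡ-* {suc n} c f = begin
    ∑ (λ v → c ℚ.* f v)
      ≡⟨ ∑-suc {n} (λ v → c ℚ.* f v) ⟩
    c ℚ.* f Fin.zero ℚ.+ ∑ (λ v → c ℚ.* f (Fin.suc v))
      ≡⟨ cong (c ℚ.* f Fin.zero ℚ.+_) (∑-distribˡ-* c (f ∘ Fin.suc)) ⟩
    c ℚ.* f Fin.zero ℚ.+ c ℚ.* ∑ (f ∘ Fin.suc)
      ≡⟨ ℚ.*-distribˡ-+ c (f Fin.zero) (∑ (f ∘ Fin.suc)) ⟨
    c ℚ.* (f Fin.zero ℚ.+ ∑ (f ∘ Fin.suc))
      ≡⟨ cong (c ℚ.*_) (∑-suc f) ⟨
    c ℚ.* ∑ f                                               ∎
    where open ≡-Reasoning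

  common-denominator : ∀ {n} (y : Fin n → ℚ) →
                       ∃[ L ] Σ[ z ∈ (Fin n → ℤ) ] (∀ v → fromℤ (z v) ≡ fromℤ +[1+ L ] ℚ.* y v)
  common-denominator {zero}  y = 0 , (λ ()) , (λ ())
  common-denominator {suc n} y with common-denominator (y ∘ Fin.suc)
  ... | L , z , z≡ky = _ , z′ , z′≡dky
    where
    -- The new denominator is left to unification: ↧ (y 0) ℤ.* +[1+ L ] normalises to +[1+ _ ].
    d k : ℤ
    d = ↧ (y Fin.zero)
    k = +[1+ L ]
    z′ : Fin (suc n) → ℤ
    z′ Fin.zero    = k ℤ.* ↥ (y Fin.zero)
    z′ (Fin.suc v) = d ℤ.* z v
    z′≡dky : ∀ v → fromℤ (z′ v) ≡ fromℤ (d ℤ.* k) ℚ.* y v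
    z′≡dky Fin.zero = begin
      fromℤ (k ℤ.* ↥ (y Fin.zero))          ≡⟨ fromℤ-* k (↥ (y Fin.zero)) ⟩
      fromℤ k ℚ.* fromℤ (↥ (y Fin.zero))    ≡⟨ cong (fromℤ k ℚ.*_) (fromℤ-↧-* (y Fin.zero)) ⟨
      fromℤ k ℚ.* (fromℤ d ℚ.* y Fin.zero)  ≡⟨ ℚ.*-assoc (fromℤ k) (fromℤ d) (y Fin.zero) ⟨
      fromℤ k ℚ.* fromℤ d ℚ.* y Fin.zero    ≡⟨ cong (ℚ._* y Fin.zero) (ℚ.*-comm (fromℤ k) (fromℤ d)) ⟩
      fromℤ d ℚ.* fromℤ k ℚ.* y Fin.zero    ≡⟨ cong (ℚ._* y Fin.zero) (fromℤ-* d k) ⟨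
      fromℤ (d ℤ.* k) ℚ.* y Fin.zero        ∎
      where open ≡-Reasoning
    z′≡dky (Fin.suc v) = begin
      fromℤ (d ℤ.* z v)                         ≡⟨ fromℤ-* d (z v) ⟩
      fromℤ d ℚ.* fromℤ (z v)                   ≡⟨ cong (fromℤ d ℚ.*_) (z≡ky v) ⟩
      fromℤ d ℚ.* (fromℤ k ℚ.* y (Fin.suc v))   ≡⟨ ℚ.*-assoc (fromℤ d) (fromℤ k) (y (Fin.suc v)) ⟨
      fromℤ d ℚ.* fromℤ k ℚ.* y (Fin.suc v)     ≡⟨ cong (ℚ._* y (Fin.suc v)) (fromℤ-* d k) ⟨
      fromℤ (d ℤ.* k) ℚ.* y (Fin.suc v)         ∎
      where open ≡-Reasoning

module Indicators where

  open import Data.Integer using (_+_; _*_)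
  open IntegerSums
  open Rationals

  indicator : {P : Set} → Dec P → ℤ
  indicator P? = if does P? then 1ℤ else 0ℤ

  indicator-yes : {P : Set} (P? : Dec P) → P → indicator P? ≡ 1ℤ
  indicator-yes (yes _) _ = refl
  indicator-yes (no ¬p) p = contradiction p ¬p

  indicator-no : {P : Set} (P? : Dec P) → ¬ P → indicator P? ≡ 0ℤ
  indicator-no (yes p) ¬p = contradiction p ¬p
  indicator-no (no _)  _  = refl

  indicator-⇔ : {P Q : Set} (P? : Dec P) (Q? : Dec Q) → (P → Q) → (Q → P) → indicator P? ≡ indicator Q?
  indicator-⇔ (yes _) (yes _) _   _   = refl
  indicator-⇔ (yes p) (no ¬q) p→q _   = contradiction (p→q p) ¬q
  indicator-⇔ (no ¬p) (yes q) _   q→p = contradiction (q→p q) ¬p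
  indicator-⇔ (no _)  (no _)  _   _   = refl

  indicator-⊎ : {P Q : Set} (P? : Dec P) (Q? : Dec Q) → (P → ¬ Q) → indicator (P? ⊎-dec Q?) ≡ indicator P? + indicator Q?
  indicator-⊎ (yes p) (yes q) P→¬Q = contradiction q (P→¬Q p)
  indicator-⊎ (yes _) (no _)  _    = refl
  indicator-⊎ (no _)  (yes _) _    = refl
  indicator-⊎ (no _)  (no _)  _    = refl

  sum-indicator-interval : ∀ n lo hi (g : ℕ → ℤ) → lo ≤ suc hi → hi < n →
    sum n (λ d → indicator (lo ℕ.≤? d ×-dec d ℕ.≤? hi) * g d) ≡ sum (suc hi ∸ lo) (λ i → g (lo ℕ.+ i))
  sum-indicator-interval n lo hi g lo≤1+hi hi<n = begin
    sum n F
      ≡⟨ cong (λ l → sum l F) lo+L+r≡n ⟨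
    sum (lo ℕ.+ (L ℕ.+ r)) F
      ≡⟨ sum-++ lo (L ℕ.+ r) F ⟩
    sum lo F + sum (L ℕ.+ r) (λ i → F (lo ℕ.+ i))
      ≡⟨ cong₂ _+_ (sum-zero lo below) (sum-++ L r (λ i → F (lo ℕ.+ i))) ⟩
    0ℤ + (sum L (λ i → F (lo ℕ.+ i)) + sum r (λ i → F (lo ℕ.+ (L ℕ.+ i))))
      ≡⟨ ℤ.+-identityˡ _ ⟩
    sum L (λ i → F (lo ℕ.+ i)) + sum r (λ i → F (lo ℕ.+ (L ℕ.+ i)))
      ≡⟨ cong₂ _+_ (sum-cong L inside) (sum-zero r above) ⟩
    sum L (λ i → g (lo ℕ.+ i)) + 0ℤ
      ≡⟨ ℤ.+-identityʳ _ ⟩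
    sum L (λ i → g (lo ℕ.+ i))
      ∎
    where
    open ≡-Reasoning
    F : ℕ → ℤ
    F d = indicator (lo ℕ.≤? d ×-dec d ℕ.≤? hi) * g d
    L r : ℕ
    L = suc hi ∸ lo
    r = n ∸ suc hi
    lo+L≡1+hi : lo ℕ.+ L ≡ suc hi
    lo+L≡1+hi = ℕ.m+[n∸m]≡n lo≤1+hi
    lo+L+r≡n : lo ℕ.+ (L ℕ.+ r) ≡ n
    lo+L+r≡n = trans (sym (ℕ.+-assoc lo L r)) (trans (cong (ℕ._+ r) lo+L≡1+hi) (ℕ.m+[n∸m]≡n hi<n))
    outside : ∀ {d} → ¬ (lo ≤ d × d ≤ hi) → F d ≡ 0ℤ
    outside {d} ∉ = trans (cong (_* g d) (indicator-no (lo ℕ.≤? d ×-dec d ℕ.≤? hi) ∉)) (ℤ.*-zeroˡ (g d))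
    below : ∀ i → i < lo → F i ≡ 0ℤ
    below i i<lo = outside (λ (lo≤i , _) → ℕ.<⇒≱ i<lo lo≤i)
    above : ∀ i → i < r → F (lo ℕ.+ (L ℕ.+ i)) ≡ 0ℤ
    above i _ = outside (λ (_ , ≤hi) → ℕ.<⇒≱ hi<lo+L+i ≤hi)
      where
      hi<lo+L+i : hi < lo ℕ.+ (L ℕ.+ i)
      hi<lo+L+i = subst (hi <_) (ℕ.+-assoc lo L i) (ℕ.≤-trans (ℕ.≤-reflexive (sym lo+L≡1+hi)) (ℕ.m≤m+n (lo ℕ.+ L) i))
    inside : ∀ i → i < L → F (lo ℕ.+ i) ≡ g (lo ℕ.+ i)
    inside i i<L =
      trans (cong (_* g (lo ℕ.+ i)) (indicator-yes (lo ℕ.≤? lo ℕ.+ i ×-dec lo ℕ.+ i ℕ.≤? hi) (ℕ.m≤m+n lo i , lo+i≤hi)))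
            (ℤ.*-identityˡ (g (lo ℕ.+ i)))
      where
      lo+i≤hi : lo ℕ.+ i ≤ hi
      lo+i≤hi = ℕ.≤-pred (subst (lo ℕ.+ i <_) lo+L≡1+hi (ℕ.+-monoʳ-< lo i<L))

  sum-indicator-≡ : ∀ n x (g : ℕ → ℤ) → x < n → sum n (λ d → indicator (d ℕ.≟ x) * g d) ≡ g x
  sum-indicator-≡ n x g x<n = begin
    sum n (λ d → indicator (d ℕ.≟ x) * g d)                    ≡⟨ sum-cong n (λ d _ → cong (_* g d) (as-interval d)) ⟩
    sum n (λ d → indicator (x ℕ.≤? d ×-dec d ℕ.≤? x) * g d)    ≡⟨ sum-indicator-interval n x x g (ℕ.n≤1+n x) x<n ⟩
    sum (suc x ∸ x) (λ i → g (x ℕ.+ i))                        ≡⟨ cong (λ l → sum l (λ i → g (x ℕ.+ i))) 1+x∸x≡1 ⟩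
    g (x ℕ.+ 0) + 0ℤ                                           ≡⟨ trans (ℤ.+-identityʳ _) (cong g (ℕ.+-identityʳ x)) ⟩
    g x                                                        ∎
    where
    open ≡-Reasoning
    as-interval : ∀ d → indicator (d ℕ.≟ x) ≡ indicator (x ℕ.≤? d ×-dec d ℕ.≤? x)
    as-interval d = indicator-⇔ (d ℕ.≟ x) (x ℕ.≤? d ×-dec d ℕ.≤? x)
      (λ { refl → ℕ.≤-refl , ℕ.≤-refl }) (λ (x≤d , d≤x) → ℕ.≤-antisym d≤x x≤d)
    1+x∸x≡1 : suc x ∸ x ≡ 1
    1+x∸x≡1 = trans (ℕ.+-∸-assoc 1 (ℕ.≤-refl {x})) (cong suc (ℕ.n∸n≡0 x))

  adjMatrix≡indicator : ∀ {n} (G : Graph n) u v → adjMatrix G u v ≡ fromℤ (indicator (adj? G u v))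
  adjMatrix≡indicator G u v with adj? G u v
  ... | yes _ = refl
  ... | no  _ = refl

  length-filter : ∀ {A : Set} {P : Pred A 0ℓ} (P? : Decidable P) xs →
    fromℤ (+ length (filter P? xs)) ≡ foldr ℚ._+_ 0ℚ (map (λ x → fromℤ (indicator (P? x))) xs)
  length-filter P? []       = refl
  length-filter P? (x ∷ xs) with does (P? x)
  ... | true  = trans (fromℤ-+ (+ 1) (+ length (filter P? xs))) (cong (1ℚ ℚ.+_) (length-filter P? xs))
  ... | false = trans (length-filter P? xs) (sym (ℚ.+-identityˡ _))

  degree≡∑ : ∀ {n} (G : Graph n) u → fromℤ (+ degree G u) ≡ ∑ (λ v → adjMatrix G u v ℚ.* 1ℚ)
  degree≡∑ {n} G u = trans (length-filter (adj? G u) (allFin n))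
    (cong (foldr ℚ._+_ 0ℚ) (List.map-cong (λ v → trans (sym (adjMatrix≡indicator G u v)) (sym (ℚ.*-identityʳ _))) (allFin n)))

module Rotation (N : ℕ) .{{_ : NonZero N}} {a j : ℕ} (a<N : a < N) (j<N : j < N) where

  private
    i : ℕ
    i = (a ℕ.+ j) % N

    wraps-once : (a ℕ.+ j ≡ i) ⊎ (i ℕ.+ N ≡ a ℕ.+ j)
    wraps-once with a ℕ.+ j ℕ.<? N
    ... | yes a+j<N = inj₁ (sym (m<n⇒m%n≡m a+j<N))
    ... | no  a+j≮N = inj₂ (begin
      i ℕ.+ N                         ≡⟨ cong (λ x → x % N ℕ.+ N) (ℕ.m∸n+n≡m N≤a+j) ⟨
      (a ℕ.+ j ∸ N ℕ.+ N) % N ℕ.+ N   ≡⟨ cong (ℕ._+ N) ([m+n]%n≡m%n (a ℕ.+ j ∸ N) N) ⟩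
      (a ℕ.+ j ∸ N) % N ℕ.+ N         ≡⟨ cong (ℕ._+ N) (m<n⇒m%n≡m a+j∸N<N) ⟩
      a ℕ.+ j ∸ N ℕ.+ N               ≡⟨ ℕ.m∸n+n≡m N≤a+j ⟩
      a ℕ.+ j                         ∎)
      where
      open ≡-Reasoning
      N≤a+j : N ≤ a ℕ.+ j
      N≤a+j = ℕ.≮⇒≥ a+j≮N
      a+j∸N<N : a ℕ.+ j ∸ N < N
      a+j∸N<N = ℕ.+-cancelʳ-< _ _ N (subst (_< N ℕ.+ N) (sym (ℕ.m∸n+n≡m N≤a+j)) (ℕ.+-mono-< a<N j<N))

    N∸j<N : ¬ j ≡ 0 → N ∸ j < N
    N∸j<N j≢0 = ℕ.∸-monoʳ-< (ℕ.n≢0⇒n>0 j≢0) (ℕ.<⇒≤ j<N)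

  [i+N∸a]%N≡j : (i ℕ.+ N ∸ a) % N ≡ j
  [i+N∸a]%N≡j with wraps-once
  ... | inj₁ a+j≡i = begin
    (i ℕ.+ N ∸ a) % N            ≡⟨ cong (λ x → (x ℕ.+ N ∸ a) % N) a+j≡i ⟨
    (a ℕ.+ j ℕ.+ N ∸ a) % N      ≡⟨ cong (λ x → (x ∸ a) % N) (ℕ.+-assoc a j N) ⟩
    (a ℕ.+ (j ℕ.+ N) ∸ a) % N    ≡⟨ cong (_% N) (ℕ.m+n∸m≡n a (j ℕ.+ N)) ⟩
    (j ℕ.+ N) % N                ≡⟨ [m+n]%n≡m%n j N ⟩
    j % N                        ≡⟨ m<n⇒m%n≡m j<N ⟩
    j                            ∎
    where open ≡-Reasoning
  ... | inj₂ i+N≡a+j = begin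
    (i ℕ.+ N ∸ a) % N            ≡⟨ cong (λ x → (x ∸ a) % N) i+N≡a+j ⟩
    (a ℕ.+ j ∸ a) % N            ≡⟨ cong (_% N) (ℕ.m+n∸m≡n a j) ⟩
    j % N                        ≡⟨ m<n⇒m%n≡m j<N ⟩
    j                            ∎
    where open ≡-Reasoning

  [a+N∸i]%N≡N∸j : ¬ j ≡ 0 → (a ℕ.+ N ∸ i) % N ≡ N ∸ j
  [a+N∸i]%N≡N∸j j≢0 with wraps-once
  ... | inj₁ a+j≡i = begin
    (a ℕ.+ N ∸ i) % N              ≡⟨ cong (λ x → (a ℕ.+ N ∸ x) % N) a+j≡i ⟨
    (a ℕ.+ N ∸ (a ℕ.+ j)) % N      ≡⟨ cong (_% N) (ℕ.[m+n]∸[m+o]≡n∸o a N j) ⟩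
    (N ∸ j) % N                    ≡⟨ m<n⇒m%n≡m (N∸j<N j≢0) ⟩
    N ∸ j                          ∎
    where open ≡-Reasoning
  ... | inj₂ i+N≡a+j = begin
    (a ℕ.+ N ∸ i) % N              ≡⟨ cong (λ x → (x ∸ i) % N) (ℕ.+-cancelʳ-≡ j _ _ N∸j+N+i+j≡a+N+j) ⟨
    ((N ∸ j) ℕ.+ N ℕ.+ i ∸ i) % N  ≡⟨ cong (_% N) (ℕ.m+n∸n≡m ((N ∸ j) ℕ.+ N) i) ⟩
    ((N ∸ j) ℕ.+ N) % N            ≡⟨ [m+n]%n≡m%n (N ∸ j) N ⟩
    (N ∸ j) % N                    ≡⟨ m<n⇒m%n≡m (N∸j<N j≢0) ⟩
    N ∸ j                          ∎
    where
    open ≡-Reasoning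
    rearrange : ∀ d n i j → d ℕ.+ n ℕ.+ i ℕ.+ j ≡ (d ℕ.+ j) ℕ.+ (i ℕ.+ n)
    rearrange = solve-∀
    swap : ∀ n a j → n ℕ.+ (a ℕ.+ j) ≡ a ℕ.+ n ℕ.+ j
    swap = solve-∀
    N∸j+N+i+j≡a+N+j : (N ∸ j) ℕ.+ N ℕ.+ i ℕ.+ j ≡ a ℕ.+ N ℕ.+ j
    N∸j+N+i+j≡a+N+j = begin
      (N ∸ j) ℕ.+ N ℕ.+ i ℕ.+ j       ≡⟨ rearrange (N ∸ j) N i j ⟩
      ((N ∸ j) ℕ.+ j) ℕ.+ (i ℕ.+ N)   ≡⟨ cong₂ ℕ._+_ (ℕ.m∸n+n≡m (ℕ.<⇒≤ j<N)) i+N≡a+j ⟩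
      N ℕ.+ (a ℕ.+ j)                 ≡⟨ swap N a j ⟩
      a ℕ.+ N ℕ.+ j                   ∎

  a≡i⇒j≡0 : a ≡ i → j ≡ 0
  a≡i⇒j≡0 a≡i with wraps-once
  ... | inj₁ a+j≡i   = ℕ.+-cancelˡ-≡ a j 0 (trans (trans a+j≡i (sym a≡i)) (sym (ℕ.+-identityʳ a)))
  ... | inj₂ i+N≡a+j = contradiction (ℕ.+-cancelˡ-≡ a N j (trans (cong (ℕ._+ N) a≡i) i+N≡a+j)) (ℕ.<⇒≢ j<N ∘ sym)

  j≡0⇒a≡i : j ≡ 0 → a ≡ i
  j≡0⇒a≡i refl = sym (trans (cong (_% N) (ℕ.+-identityʳ a)) (m<n⇒m%n≡m a<N))

module Circulant (N : ℕ) .{{_ : NonZero N}} {S : Pred ℕ 0ℓ} (S? : Decidable S) where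

  open import Data.Integer using (_+_; _*_)
  open IntegerSums
  open Iteration using (periodic-*)
  open Rationals
  open Indicators

  G : Graph N
  G = Circ N S S?

  χ : ℕ → ℤ
  χ d = indicator (S? d)

  -- Entry a of A·Y for N-periodic Y, i.e. Σ_{d∈S} (Y(a + d) + Y(a - d)) with a - d written a + (N ∸ d).
  rowSum : (ℕ → ℤ) → ℕ → ℤ
  rowSum Y a = sum N (λ d → χ d * (Y (a ℕ.+ d) + Y (a ℕ.+ (N ∸ d))))

  rowSum-cong : ∀ {Y Y′} → (∀ x → Y x ≡ Y′ x) → ∀ a → rowSum Y a ≡ rowSum Y′ a
  rowSum-cong Y≗Y′ a = sum-cong N (λ d _ → cong (χ d *_) (cong₂ _+_ (Y≗Y′ (a ℕ.+ d)) (Y≗Y′ (a ℕ.+ (N ∸ d)))))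

  rowSum-+ : ∀ Y Y′ a → rowSum (λ x → Y x + Y′ x) a ≡ rowSum Y a + rowSum Y′ a
  rowSum-+ Y Y′ a =
    trans (sum-cong N (λ d _ → distrib (χ d) (Y (a ℕ.+ d)) (Y′ (a ℕ.+ d)) (Y (a ℕ.+ (N ∸ d))) (Y′ (a ℕ.+ (N ∸ d)))))
          (sum-distrib-+ N _ _)
    where
    distrib : ∀ c y y′ z z′ → c * ((y + y′) + (z + z′)) ≡ c * (y + z) + c * (y′ + z′)
    distrib = ℤsolve-∀

  rowSum-*ʳ : ∀ Y c a → rowSum (λ x → Y x * c) a ≡ rowSum Y a * c
  rowSum-*ʳ Y c a = trans (sum-cong N (λ d _ → distrib (χ d) (Y (a ℕ.+ d)) (Y (a ℕ.+ (N ∸ d))) c))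
                          (trans (sum-distribˡ-* N c _) (ℤ.*-comm c (rowSum Y a)))
    where
    distrib : ∀ χ y z c → χ * (y * c + z * c) ≡ c * (χ * (y + z))
    distrib = ℤsolve-∀

  rowSum-shift : ∀ Y s a → rowSum (λ x → Y (s ℕ.+ x)) a ≡ rowSum Y (s ℕ.+ a)
  rowSum-shift Y s a =
    sum-cong N (λ d _ → cong (χ d *_) (cong₂ _+_ (cong Y (sym (ℕ.+-assoc s a d))) (cong Y (sym (ℕ.+-assoc s a (N ∸ d))))))

  sum-rowSum : ∀ p q → Periodic p q → sum p (rowSum q) ≡ sum N (λ d → χ d * (sum p q + sum p q))
  sum-rowSum p q per = begin
    sum p (λ a → sum N (λ d → χ d * (q (a ℕ.+ d) + q (a ℕ.+ (N ∸ d)))))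
      ≡⟨ sum-comm p N (λ a d → χ d * (q (a ℕ.+ d) + q (a ℕ.+ (N ∸ d)))) ⟩
    sum N (λ d → sum p (λ a → χ d * (q (a ℕ.+ d) + q (a ℕ.+ (N ∸ d)))))
      ≡⟨ sum-cong N (λ d _ → trans (sum-distribˡ-* p (χ d) _)
                                    (cong (χ d *_) (trans (sum-distrib-+ p _ _) (cong₂ _+_ (shifted d) (shifted (N ∸ d)))))) ⟩
    sum N (λ d → χ d * (sum p q + sum p q))  ∎
    where
    open ≡-Reasoning
    shifted : ∀ c → sum p (λ a → q (a ℕ.+ c)) ≡ sum p q
    shifted c = trans (sum-cong p (λ a _ → cong q (ℕ.+-comm a c))) (sum-periodic p q per c)

  periodic-% : ∀ {Y} → Periodic N Y → ∀ x → Y (x % N) ≡ Y x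
  periodic-% {Y} per x = begin
    Y (x % N)                    ≡⟨ periodic-* per (x / N) (x % N) ⟨
    Y (x / N ℕ.* N ℕ.+ x % N)    ≡⟨ cong Y (trans (ℕ.+-comm (x / N ℕ.* N) (x % N)) (sym (m≡m%n+[m/n]*n x N))) ⟩
    Y x                          ∎
    where open ≡-Reasoning

  sum-rotate-% : ∀ a (F : ℕ → ℤ) → sum N F ≡ sum N (λ j → F ((a ℕ.+ j) % N))
  sum-rotate-% a F = begin
    sum N F                            ≡⟨ sum-cong N (λ i i<N → cong F (sym (m<n⇒m%n≡m i<N))) ⟩
    sum N (λ i → F (i % N))            ≡⟨ sum-periodic N (F ∘ (_% N)) F[N+x%N]≡F[x%N] a ⟨
    sum N (λ j → F ((a ℕ.+ j) % N))    ∎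
    where
    open ≡-Reasoning
    F[N+x%N]≡F[x%N] : Periodic N (F ∘ (_% N))
    F[N+x%N]≡F[x%N] x = cong F (trans (cong (_% N) (ℕ.+-comm N x)) ([m+n]%n≡m%n x N))

  rowSum-periodic : ∀ {Y} → Periodic N Y → Periodic N (rowSum Y)
  rowSum-periodic {Y} per a = trans (sym (rowSum-shift Y N a)) (rowSum-cong per a)

  extend : (Fin N → ℤ) → ℕ → ℤ
  extend z i = z (fromℕ< (m%n<n i N))

  extend-toℕ : ∀ z v → extend z (toℕ v) ≡ z v
  extend-toℕ z v = cong z (Fin.toℕ-injective (trans (Fin.toℕ-fromℕ< _) (m<n⇒m%n≡m (Fin.toℕ<n v))))

  extend-periodic : ∀ z → Periodic N (extend z)
  extend-periodic z i = cong z (Fin.toℕ-injective (trans (Fin.toℕ-fromℕ< _)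
    (trans (cong (_% N) (ℕ.+-comm N i)) (trans ([m+n]%n≡m%n i N) (sym (Fin.toℕ-fromℕ< _))))))

  Adjacent : ℕ → ℕ → Set
  Adjacent a i = ¬ a ≡ i × (S ((a ℕ.+ N ∸ i) % N) ⊎ S ((i ℕ.+ N ∸ a) % N))

  adjacent? : ∀ a i → Dec (Adjacent a i)
  adjacent? a i = ¬? (a ℕ.≟ i) ×-dec (S? ((a ℕ.+ N ∸ i) % N) ⊎-dec S? ((i ℕ.+ N ∸ a) % N))

  Offset : ℕ → Set
  Offset j = ¬ j ≡ 0 × (S j ⊎ S (N ∸ j))

  offset? : ∀ j → Dec (Offset j)
  offset? j = ¬? (j ℕ.≟ 0) ×-dec (S? j ⊎-dec S? (N ∸ j))

  indicator-adjacent : ∀ {a j} → a < N → j < N → indicator (adjacent? a ((a ℕ.+ j) % N)) ≡ indicator (offset? j)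
  indicator-adjacent {a} {j} a<N j<N = indicator-⇔ (adjacent? a _) (offset? j) to from
    where
    open Rotation N a<N j<N
    to : Adjacent a ((a ℕ.+ j) % N) → Offset j
    to (a≢i , inj₁ s) = a≢i ∘ j≡0⇒a≡i , inj₂ (subst S ([a+N∸i]%N≡N∸j (a≢i ∘ j≡0⇒a≡i)) s)
    to (a≢i , inj₂ s) = a≢i ∘ j≡0⇒a≡i , inj₁ (subst S [i+N∸a]%N≡j s)
    from : Offset j → Adjacent a ((a ℕ.+ j) % N)
    from (j≢0 , inj₁ s) = j≢0 ∘ a≡i⇒j≡0 , inj₂ (subst S (sym [i+N∸a]%N≡j) s)
    from (j≢0 , inj₂ s) = j≢0 ∘ a≡i⇒j≡0 , inj₁ (subst S (sym ([a+N∸i]%N≡N∸j j≢0)) s)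

  module _ (short : ∀ {d} → S d → 0 < d × d < N ∸ d) where

    private
      χ-0 : χ 0 ≡ 0ℤ
      χ-0 = indicator-no (S? 0) (λ s → ℕ.<-irrefl refl (proj₁ (short s)))

      χ-N : χ N ≡ 0ℤ
      χ-N = indicator-no (S? N) (λ s → ℕ.n≮0 (subst (N <_) (ℕ.n∸n≡0 N) (proj₂ (short s))))

      ¬S[N∸d] : ∀ {d} → S d → ¬ S (N ∸ d)
      ¬S[N∸d] {d} s s′ = ℕ.<-asym (proj₂ (short s)) (subst (N ∸ d <_) (ℕ.m∸[m∸n]≡n d≤N) (proj₂ (short s′)))
        where
        d≤N : d ≤ N
        d≤N = ℕ.≤-trans (ℕ.<⇒≤ (proj₂ (short s))) (ℕ.m∸n≤m N d)

    indicator-offset : ∀ j → indicator (offset? j) ≡ χ j + χ (N ∸ j)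
    indicator-offset zero    = sym (cong₂ _+_ χ-0 χ-N)
    indicator-offset (suc j) with S? (suc j) | S? (N ∸ suc j)
    ... | yes s | yes s′ = contradiction s′ (¬S[N∸d] s)
    ... | yes _ | no _   = refl
    ... | no _  | yes _  = refl
    ... | no _  | no _   = refl

    sum-offset : ∀ (g : ℕ → ℤ) → sum N (λ j → indicator (offset? j) * g j) ≡ sum N (λ d → χ d * (g d + g (N ∸ d)))
    sum-offset g = begin
      sum N (λ j → indicator (offset? j) * g j)
        ≡⟨ sum-cong N (λ j _ → trans (cong (_* g j) (indicator-offset j)) (ℤ.*-distribʳ-+ (g j) (χ j) (χ (N ∸ j)))) ⟩
      sum N (λ j → χ j * g j + χ (N ∸ j) * g j)
        ≡⟨ sum-distrib-+ N (λ j → χ j * g j) (λ j → χ (N ∸ j) * g j) ⟩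
      sum N (λ j → χ j * g j) + sum N (λ j → χ (N ∸ j) * g j)
        ≡⟨ cong (_+_ (sum N (λ j → χ j * g j))) reflected ⟩
      sum N (λ d → χ d * g d) + sum N (λ d → χ d * g (N ∸ d))
        ≡⟨ sum-distrib-+ N (λ d → χ d * g d) (λ d → χ d * g (N ∸ d)) ⟨
      sum N (λ d → χ d * g d + χ d * g (N ∸ d))
        ≡⟨ sum-cong N (λ d _ → sym (ℤ.*-distribˡ-+ (χ d) (g d) (g (N ∸ d)))) ⟩
      sum N (λ d → χ d * (g d + g (N ∸ d)))  ∎
      where
      open ≡-Reasoning
      H : ℕ → ℤ
      H d = χ d * g (N ∸ d)
      H-zero : ∀ {d} → χ d ≡ 0ℤ → H d ≡ 0ℤ
      H-zero {d} χd≡0 = trans (cong (_* g (N ∸ d)) χd≡0) (ℤ.*-zeroˡ (g (N ∸ d)))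
      reflected : sum N (λ j → χ (N ∸ j) * g j) ≡ sum N H
      reflected = trans (sum-cong N (λ j j<N → cong (λ i → χ (N ∸ j) * g i) (sym (ℕ.m∸[m∸n]≡n (ℕ.<⇒≤ j<N)))))
                        (sum-reflect N H (trans (H-zero χ-N) (sym (H-zero χ-0))))

    ∑adjMatrix≡rowSum : ∀ Y → Periodic N Y → ∀ u →
      ∑ (λ v → adjMatrix G u v ℚ.* fromℤ (Y (toℕ v))) ≡ fromℤ (rowSum Y (toℕ u))
    ∑adjMatrix≡rowSum Y per u = begin
      ∑ {N} (λ v → adjMatrix G u v ℚ.* fromℤ (Y (toℕ v)))
        ≡⟨ ∑-cong (λ v → trans (cong (ℚ._* fromℤ (Y (toℕ v))) (adjMatrix≡indicator G u v))
                               (sym (fromℤ-* (A (toℕ v)) (Y (toℕ v))))) ⟩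
      ∑ {N} (λ v → fromℤ (A (toℕ v) * Y (toℕ v)))
        ≡⟨ ∑-fromℤ N (λ i → A i * Y i) ⟩
      fromℤ (sum N (λ i → A i * Y i))
        ≡⟨ cong fromℤ (sum-rotate-% a (λ i → A i * Y i)) ⟩
      fromℤ (sum N (λ j → A ((a ℕ.+ j) % N) * Y ((a ℕ.+ j) % N)))
        ≡⟨ cong fromℤ (sum-cong N (λ j j<N → cong₂ _*_ (indicator-adjacent (Fin.toℕ<n u) j<N) (periodic-% per (a ℕ.+ j)))) ⟩
      fromℤ (sum N (λ j → indicator (offset? j) * Y (a ℕ.+ j)))
        ≡⟨ cong fromℤ (sum-offset (λ j → Y (a ℕ.+ j))) ⟩
      fromℤ (rowSum Y a)  ∎
      where
      open ≡-Reasoning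
      a : ℕ
      a = toℕ u
      A : ℕ → ℤ
      A i = indicator (adjacent? a i)

    integral-null : ∀ {y} L z → (∀ v → fromℤ (z v) ≡ fromℤ +[1+ L ] ℚ.* y v) → InNullSpace G y →
                    ∀ a → rowSum (extend z) a ≡ 0ℤ
    integral-null {y} L z z≡ky y-null a =
      trans (sym (periodic-% (rowSum-periodic (extend-periodic z)) a)) (null-below-N (a % N) (m%n<n a N))
      where
      k : ℚ
      k = fromℤ +[1+ L ]
      null-below-N : ∀ a → a < N → rowSum (extend z) a ≡ 0ℤ
      null-below-N a a<N = fromℤ-injective (begin
        fromℤ (rowSum (extend z) a)                              ≡⟨ cong (λ b → fromℤ (rowSum (extend z) b)) (Fin.toℕ-fromℕ< a<N) ⟨
        fromℤ (rowSum (extend z) (toℕ u))                        ≡⟨ ∑adjMatrix≡rowSum (extend z) (extend-periodic z) u ⟨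
        ∑ (λ v → adjMatrix G u v ℚ.* fromℤ (extend z (toℕ v)))   ≡⟨ ∑-cong scaled ⟩
        ∑ (λ v → k ℚ.* (adjMatrix G u v ℚ.* y v))                ≡⟨ ∑-distribˡ-* k (λ v → adjMatrix G u v ℚ.* y v) ⟩
        k ℚ.* ∑ (λ v → adjMatrix G u v ℚ.* y v)                  ≡⟨ cong (k ℚ.*_) (y-null u) ⟩
        k ℚ.* 0ℚ                                                 ≡⟨ ℚ.*-zeroʳ k ⟩
        0ℚ                                                       ∎)
        where
        open ≡-Reasoning
        u : Fin N
        u = fromℕ< a<N
        scaled : ∀ v → adjMatrix G u v ℚ.* fromℤ (extend z (toℕ v)) ≡ k ℚ.* (adjMatrix G u v ℚ.* y v)
        scaled v = begin
          adjMatrix G u v ℚ.* fromℤ (extend z (toℕ v))   ≡⟨ cong (λ w → adjMatrix G u v ℚ.* fromℤ w) (extend-toℕ z v) ⟩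
          adjMatrix G u v ℚ.* fromℤ (z v)                ≡⟨ cong (adjMatrix G u v ℚ.*_) (z≡ky v) ⟩
          adjMatrix G u v ℚ.* (k ℚ.* y v)                ≡⟨ ℚ.*-assoc (adjMatrix G u v) k (y v) ⟨
          adjMatrix G u v ℚ.* k ℚ.* y v                  ≡⟨ cong (ℚ._* y v) (ℚ.*-comm (adjMatrix G u v) k) ⟩
          k ℚ.* adjMatrix G u v ℚ.* y v                  ≡⟨ ℚ.*-assoc k (adjMatrix G u v) (y v) ⟩
          k ℚ.* (adjMatrix G u v ℚ.* y v)                ∎

module GeneratingSet (T K : ℕ) (T≤K : T ≤ K) where

  open import Data.Integer using (_+_; _*_)
  open IntegerSums
  open Indicators

  -- t = T + 1 and n = 4K + 10; then n ≥ 4t + 6 is T ≤ K, h = n/2 and m = (n+2)/4.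
  h N m : ℕ
  h = 5 ℕ.+ 2 ℕ.* K
  N = h ℕ.+ h
  m = 3 ℕ.+ K

  S : ℕ → Set
  S = S'' (suc T) N

  open Circulant N (S''? (suc T) N) public

  [N+2]/4≡m : (N ℕ.+ 2) / 4 ≡ m
  [N+2]/4≡m = trans (cong (_/ 4) (identity K)) (m*n/n≡m m 4)
    where
    identity : ∀ K → (5 ℕ.+ 2 ℕ.* K) ℕ.+ (5 ℕ.+ 2 ℕ.* K) ℕ.+ 2 ≡ (3 ℕ.+ K) ℕ.* 4
    identity = solve-∀

  [N+6]/4≡1+m : (N ℕ.+ 6) / 4 ≡ suc m
  [N+6]/4≡1+m = trans (cong (_/ 4) (identity K)) (m*n/n≡m (suc m) 4)
    where
    identity : ∀ K → (5 ℕ.+ 2 ℕ.* K) ℕ.+ (5 ℕ.+ 2 ℕ.* K) ℕ.+ 6 ≡ (4 ℕ.+ K) ℕ.* 4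
    identity = solve-∀

  N/2≡h : N / 2 ≡ h
  N/2≡h = trans (cong (_/ 2) (identity h)) (m*n/n≡m h 2)
    where
    identity : ∀ h → h ℕ.+ h ≡ h ℕ.* 2
    identity = solve-∀

  private
    ≤-witness : ∀ {x y} e → x ℕ.+ e ≡ y → x ≤ y
    ≤-witness e refl = ℕ.m≤m+n _ e

    T<m : T < m
    T<m = s≤s (ℕ.≤-trans T≤K (ℕ.m≤n+m K 2))

    1+m<h : suc m < h
    1+m<h = ≤-witness K (identity K)
      where
      identity : ∀ K → suc (suc (3 ℕ.+ K)) ℕ.+ K ≡ 5 ℕ.+ 2 ℕ.* K
      identity = solve-∀

    m<h : m < h
    m<h = ℕ.<-trans (ℕ.n<1+n m) 1+m<h

    T<h : T < h
    T<h = ℕ.<-trans T<m m<h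

    2+m≤h∸T : suc (suc m) ≤ h ∸ T
    2+m≤h∸T = ℕ.≤-trans (ℕ.≤-reflexive (sym h∸K≡2+m)) (ℕ.∸-monoʳ-≤ h T≤K)
      where
      identity : ∀ K → 5 ℕ.+ 2 ℕ.* K ≡ (5 ℕ.+ K) ℕ.+ K
      identity = solve-∀
      h∸K≡2+m : h ∸ K ≡ suc (suc m)
      h∸K≡2+m = trans (cong (_∸ K) (identity K)) (ℕ.m+n∸n≡m (5 ℕ.+ K) K)

  S-bounds : ∀ {d} → S d → 1 ≤ d × d < h
  S-bounds (inj₁ (1≤d , d≤T))                = 1≤d , ℕ.≤-<-trans d≤T T<h
  S-bounds (inj₂ (inj₁ d≡))                  rewrite trans d≡ [N+2]/4≡m   = s≤s z≤n , m<h
  S-bounds (inj₂ (inj₂ (inj₁ d≡)))           rewrite trans d≡ [N+6]/4≡1+m = s≤s z≤n , 1+m<h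
  S-bounds (inj₂ (inj₂ (inj₂ (lo≤d , d≤hi)))) rewrite N/2≡h =
    ℕ.≤-trans (s≤s z≤n) (ℕ.≤-trans 2+m≤h∸T lo≤d) , s≤s d≤hi

  short : ∀ {d} → S d → 0 < d × d < N ∸ d
  short {d} s = proj₁ (S-bounds s) , ℕ.<-≤-trans (proj₂ (S-bounds s)) h≤N∸d
    where
    h≤N∸d : h ≤ N ∸ d
    h≤N∸d = ℕ.≤-trans (ℕ.≤-reflexive (sym (ℕ.m+n∸n≡m h h))) (ℕ.∸-monoʳ-≤ N (ℕ.<⇒≤ (proj₂ (S-bounds s))))

  χ-split : ∀ d → χ d ≡ indicator (1 ℕ.≤? d ×-dec d ℕ.≤? T)
                      + (indicator (d ℕ.≟ m) + (indicator (d ℕ.≟ suc m) + indicator (h ∸ T ℕ.≤? d ×-dec d ℕ.≤? h ∸ 1)))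
  χ-split d = begin
    indicator (A? ⊎-dec (B? ⊎-dec (C? ⊎-dec D?)))
      ≡⟨ indicator-⊎ A? (B? ⊎-dec (C? ⊎-dec D?)) below-m ⟩
    indicator A? + indicator (B? ⊎-dec (C? ⊎-dec D?))
      ≡⟨ cong (_+_ (indicator A?)) (indicator-⊎ B? (C? ⊎-dec D?) at-m) ⟩
    indicator A? + (indicator B? + indicator (C? ⊎-dec D?))
      ≡⟨ cong (λ x → indicator A? + (indicator B? + x)) (indicator-⊎ C? D? at-1+m) ⟩
    indicator A? + (indicator B? + (indicator C? + indicator D?))
      ≡⟨ cong₂ (λ x y → indicator A? + (indicator (d ℕ.≟ x) + y)) [N+2]/4≡m
               (cong₂ (λ x y → indicator (d ℕ.≟ x) + indicator (y ∸ T ℕ.≤? d ×-dec d ℕ.≤? y ∸ 1)) [N+6]/4≡1+m N/2≡h) ⟩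
    indicator A? + (indicator (d ℕ.≟ m) + (indicator (d ℕ.≟ suc m) + indicator (h ∸ T ℕ.≤? d ×-dec d ℕ.≤? h ∸ 1))) ∎
    where
    open ≡-Reasoning
    A? : Dec (1 ≤ d × d ≤ T)
    A? = 1 ℕ.≤? d ×-dec d ℕ.≤? T
    B? : Dec (d ≡ (N ℕ.+ 2) / 4)
    B? = d ℕ.≟ (N ℕ.+ 2) / 4
    C? : Dec (d ≡ (N ℕ.+ 6) / 4)
    C? = d ℕ.≟ (N ℕ.+ 6) / 4
    D? : Dec (N / 2 ∸ T ≤ d × d ≤ N / 2 ∸ 1)
    D? = N / 2 ∸ T ℕ.≤? d ×-dec d ℕ.≤? N / 2 ∸ 1
    d≡m : d ≡ (N ℕ.+ 2) / 4 → d ≡ m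
    d≡m d≡ = trans d≡ [N+2]/4≡m
    d≡1+m : d ≡ (N ℕ.+ 6) / 4 → d ≡ suc m
    d≡1+m d≡ = trans d≡ [N+6]/4≡1+m
    above-2+m : N / 2 ∸ T ≤ d → suc (suc m) ≤ d
    above-2+m lo≤d = ℕ.≤-trans 2+m≤h∸T (subst (λ x → x ∸ T ≤ d) N/2≡h lo≤d)
    above-1+m : d ≡ (N ℕ.+ 6) / 4 ⊎ N / 2 ∸ T ≤ d × d ≤ N / 2 ∸ 1 → suc m ≤ d
    above-1+m (inj₁ d≡)         = ℕ.≤-reflexive (sym (d≡1+m d≡))
    above-1+m (inj₂ (lo≤d , _)) = ℕ.≤-trans (ℕ.n≤1+n (suc m)) (above-2+m lo≤d)
    below-m : 1 ≤ d × d ≤ T → ¬ (d ≡ (N ℕ.+ 2) / 4 ⊎ d ≡ (N ℕ.+ 6) / 4 ⊎ N / 2 ∸ T ≤ d × d ≤ N / 2 ∸ 1)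
    below-m (_ , d≤T) (inj₁ d≡)   = ℕ.<⇒≢ (ℕ.≤-<-trans d≤T T<m) (d≡m d≡)
    below-m (_ , d≤T) (inj₂ rest) = ℕ.<⇒≱ (ℕ.≤-<-trans d≤T T<m) (ℕ.≤-trans (ℕ.n≤1+n m) (above-1+m rest))
    at-m : d ≡ (N ℕ.+ 2) / 4 → ¬ (d ≡ (N ℕ.+ 6) / 4 ⊎ N / 2 ∸ T ≤ d × d ≤ N / 2 ∸ 1)
    at-m d≡ rest = ℕ.<⇒≢ (above-1+m rest) (sym (d≡m d≡))
    at-1+m : d ≡ (N ℕ.+ 6) / 4 → ¬ (N / 2 ∸ T ≤ d × d ≤ N / 2 ∸ 1)
    at-1+m d≡ (lo≤d , _) = ℕ.<⇒≢ (above-2+m lo≤d) (sym (d≡1+m d≡))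

  sum-χ : ∀ (g : ℕ → ℤ) →
    sum N (λ d → χ d * g d) ≡ sum T (λ i → g (suc i)) + (g m + (g (suc m) + sum T (λ i → g (h ∸ T ℕ.+ i))))
  sum-χ g = begin
    sum N (λ d → χ d * g d)
      ≡⟨ sum-cong N {λ d → χ d * g d} (λ d _ → trans (cong (_* g d) (χ-split d))
                                                      (distrib (I₁ d) (I₂ d) (I₃ d) (I₄ d) (g d))) ⟩
    sum N (λ d → I₁ d * g d + (I₂ d * g d + (I₃ d * g d + I₄ d * g d)))
      ≡⟨ sum-distrib-+ N (λ d → I₁ d * g d) (λ d → I₂ d * g d + (I₃ d * g d + I₄ d * g d)) ⟩
    sum N (λ d → I₁ d * g d) + sum N (λ d → I₂ d * g d + (I₃ d * g d + I₄ d * g d))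
      ≡⟨ cong (_+_ (sum N (λ d → I₁ d * g d))) (trans (sum-distrib-+ N (λ d → I₂ d * g d) (λ d → I₃ d * g d + I₄ d * g d))
              (cong (_+_ (sum N (λ d → I₂ d * g d))) (sum-distrib-+ N (λ d → I₃ d * g d) (λ d → I₄ d * g d)))) ⟩
    sum N (λ d → I₁ d * g d) + (sum N (λ d → I₂ d * g d) + (sum N (λ d → I₃ d * g d) + sum N (λ d → I₄ d * g d)))
      ≡⟨ cong₂ _+_ (sum-indicator-interval N 1 T g (s≤s z≤n) T<N)
           (cong₂ _+_ (sum-indicator-≡ N m g m<N) (cong₂ _+_ (sum-indicator-≡ N (suc m) g 1+m<N) upper-block)) ⟩
    sum T (λ i → g (suc i)) + (g m + (g (suc m) + sum T (λ i → g (h ∸ T ℕ.+ i)))) ∎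
    where
    open ≡-Reasoning
    I₁ I₂ I₃ I₄ : ℕ → ℤ
    I₁ d = indicator (1 ℕ.≤? d ×-dec d ℕ.≤? T)
    I₂ d = indicator (d ℕ.≟ m)
    I₃ d = indicator (d ℕ.≟ suc m)
    I₄ d = indicator (h ∸ T ℕ.≤? d ×-dec d ℕ.≤? h ∸ 1)
    distrib : ∀ a b c e x → (a + (b + (c + e))) * x ≡ a * x + (b * x + (c * x + e * x))
    distrib = ℤsolve-∀
    h≤N : h ≤ N
    h≤N = ℕ.m≤m+n h h
    T<N : T < N
    T<N = ℕ.<-≤-trans T<h h≤N
    m<N : m < N
    m<N = ℕ.<-≤-trans m<h h≤N
    1+m<N : suc m < N
    1+m<N = ℕ.<-≤-trans 1+m<h h≤N
    upper-block : sum N (λ d → I₄ d * g d) ≡ sum T (λ i → g (h ∸ T ℕ.+ i))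
    upper-block = trans (sum-indicator-interval N (h ∸ T) (h ∸ 1) g (ℕ.m∸n≤m h T) (ℕ.<-≤-trans (ℕ.n<1+n (h ∸ 1)) h≤N))
                        (cong (λ l → sum l (λ i → g (h ∸ T ℕ.+ i))) (ℕ.m∸[m∸n]≡n (ℕ.<⇒≤ T<h)))

  sum-χ-const : ∀ c → sum N (λ d → χ d * c) ≡ + (2 ℕ.* suc T) * c
  sum-χ-const c = begin
    sum N (λ d → χ d * c)                          ≡⟨ sum-χ (λ _ → c) ⟩
    sum T (λ _ → c) + (c + (c + sum T (λ _ → c)))  ≡⟨ cong₂ (λ x y → x + (c + (c + y))) (sum-const T c) (sum-const T c) ⟩
    + T * c + (c + (c + + T * c))                  ≡⟨ identity (+ T) c ⟩
    (+ 2 * (+ 1 + + T)) * c                        ≡⟨ cong (_* c) (ℤ.pos-* 2 (suc T)) ⟨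
    + (2 ℕ.* suc T) * c                            ∎
    where
    open ≡-Reasoning
    identity : ∀ t c → t * c + (c + (c + t * c)) ≡ (+ 2 * (+ 1 + t)) * c
    identity = ℤsolve-∀

  -- d ↦ h ∸ d exchanges the two long blocks of S, so they enter rowSum Y only through lowBlock.
  module Twisted {s : ℤ} (s*s≡1 : s * s ≡ 1ℤ) {Y : ℕ → ℤ} (twist : ∀ x → Y (h ℕ.+ x) ≡ s * Y x) where

    periodic : Periodic N Y
    periodic x = begin
      Y (h ℕ.+ h ℕ.+ x)     ≡⟨ cong Y (ℕ.+-assoc h h x) ⟩
      Y (h ℕ.+ (h ℕ.+ x))   ≡⟨ twist (h ℕ.+ x) ⟩
      s * Y (h ℕ.+ x)       ≡⟨ cong (s *_) (twist x) ⟩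
      s * (s * Y x)         ≡⟨ ℤ.*-assoc s s (Y x) ⟨
      s * s * Y x           ≡⟨ cong (_* Y x) s*s≡1 ⟩
      1ℤ * Y x              ≡⟨ ℤ.*-identityˡ (Y x) ⟩
      Y x                   ∎
      where open ≡-Reasoning

    untwist : ∀ x → Y x ≡ s * Y (h ℕ.+ x)
    untwist x = begin
      Y x                   ≡⟨ ℤ.*-identityˡ (Y x) ⟨
      1ℤ * Y x              ≡⟨ cong (_* Y x) s*s≡1 ⟨
      s * s * Y x           ≡⟨ ℤ.*-assoc s s (Y x) ⟩
      s * (s * Y x)         ≡⟨ cong (s *_) (twist x) ⟨
      s * Y (h ℕ.+ x)       ∎
      where open ≡-Reasoning

    g : ℕ → ℕ → ℤ
    g a d = Y (a ℕ.+ d) + Y (a ℕ.+ (N ∸ d))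

    g-reflect : ∀ a {d} → d ≤ h → g a (h ∸ d) ≡ s * g a d
    g-reflect a {d} d≤h = begin
      Y (a ℕ.+ (h ∸ d)) + Y (a ℕ.+ (N ∸ (h ∸ d)))       ≡⟨ cong₂ _+_ (untwist (a ℕ.+ (h ∸ d))) (cong Y far) ⟩
      s * Y (h ℕ.+ (a ℕ.+ (h ∸ d))) + Y (h ℕ.+ (a ℕ.+ d)) ≡⟨ cong₂ _+_ (cong (λ x → s * Y x) near) (twist (a ℕ.+ d)) ⟩
      s * Y (a ℕ.+ (N ∸ d)) + s * Y (a ℕ.+ d)           ≡⟨ ℤ.*-distribˡ-+ s (Y (a ℕ.+ (N ∸ d))) (Y (a ℕ.+ d)) ⟨
      s * (Y (a ℕ.+ (N ∸ d)) + Y (a ℕ.+ d))             ≡⟨ cong (s *_) (ℤ.+-comm (Y (a ℕ.+ (N ∸ d))) (Y (a ℕ.+ d))) ⟩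
      s * g a d                                         ∎
      where
      open ≡-Reasoning
      swap : ∀ h a x → a ℕ.+ (h ℕ.+ x) ≡ h ℕ.+ (a ℕ.+ x)
      swap = solve-∀
      far : a ℕ.+ (N ∸ (h ∸ d)) ≡ h ℕ.+ (a ℕ.+ d)
      far = begin
        a ℕ.+ (h ℕ.+ h ∸ (h ∸ d))   ≡⟨ cong (a ℕ.+_) (ℕ.+-∸-assoc h (ℕ.m∸n≤m h d)) ⟩
        a ℕ.+ (h ℕ.+ (h ∸ (h ∸ d))) ≡⟨ cong (λ x → a ℕ.+ (h ℕ.+ x)) (ℕ.m∸[m∸n]≡n d≤h) ⟩
        a ℕ.+ (h ℕ.+ d)             ≡⟨ swap h a d ⟩
        h ℕ.+ (a ℕ.+ d)             ∎
      near : h ℕ.+ (a ℕ.+ (h ∸ d)) ≡ a ℕ.+ (N ∸ d)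
      near = trans (sym (swap h a (h ∸ d))) (cong (a ℕ.+_) (sym (ℕ.+-∸-assoc h d≤h)))

    upper-block : ∀ a → sum T (λ i → g a (h ∸ T ℕ.+ i)) ≡ s * sum T (λ i → g a (suc i))
    upper-block a = begin
      sum T (λ i → g a (h ∸ T ℕ.+ i))               ≡⟨ sum-reverse T (λ i → g a (h ∸ T ℕ.+ i)) ⟩
      sum T (λ i → g a (h ∸ T ℕ.+ (T ∸ suc i)))     ≡⟨ sum-cong T (λ i i<T → cong (g a) (reindex i<T)) ⟩
      sum T (λ i → g a (h ∸ suc i))                 ≡⟨ sum-cong T (λ i i<T → g-reflect a (ℕ.≤-trans i<T (ℕ.<⇒≤ T<h))) ⟩
      sum T (λ i → s * g a (suc i))                 ≡⟨ sum-distribˡ-* T s (λ i → g a (suc i)) ⟩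
      s * sum T (λ i → g a (suc i))                 ∎
      where
      open ≡-Reasoning
      reindex : ∀ {i} → i < T → h ∸ T ℕ.+ (T ∸ suc i) ≡ h ∸ suc i
      reindex {i} i<T = trans (sym (ℕ.+-∸-assoc (h ∸ T) i<T)) (cong (_∸ suc i) (ℕ.m∸n+n≡m (ℕ.<⇒≤ T<h)))

    middle : ∀ a → let v = a ℕ.+ suc K in g a m + g a (suc m) ≡ (Y (2 ℕ.+ v) + Y (3 ℕ.+ v)) + s * (Y v + Y (1 ℕ.+ v))
    middle a = begin
      Y (a ℕ.+ m) + Y (a ℕ.+ (N ∸ m)) + (Y (a ℕ.+ suc m) + Y (a ℕ.+ (N ∸ suc m)))
        ≡⟨ cong₂ (λ x y → Y (a ℕ.+ m) + Y x + (Y (a ℕ.+ suc m) + Y y))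
                 (reflected (2 ℕ.+ K) m (identity₁ K)) (reflected (suc K) (suc m) (identity₂ K)) ⟩
      Y (a ℕ.+ m) + Y (h ℕ.+ (a ℕ.+ (2 ℕ.+ K))) + (Y (a ℕ.+ suc m) + Y (h ℕ.+ v))
        ≡⟨ cong₂ (λ x y → Y (a ℕ.+ m) + x + (Y (a ℕ.+ suc m) + y)) (twist (a ℕ.+ (2 ℕ.+ K))) (twist v) ⟩
      Y (a ℕ.+ m) + s * Y (a ℕ.+ (2 ℕ.+ K)) + (Y (a ℕ.+ suc m) + s * Y v)
        ≡⟨ cong₂ (λ x y → Y x + s * Y y + (Y (a ℕ.+ suc m) + s * Y v)) (shift₂ a K) (shift₁ a K) ⟩
      Y (2 ℕ.+ v) + s * Y (1 ℕ.+ v) + (Y (a ℕ.+ suc m) + s * Y v)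
        ≡⟨ cong (λ x → Y (2 ℕ.+ v) + s * Y (1 ℕ.+ v) + (Y x + s * Y v)) (shift₃ a K) ⟩
      Y (2 ℕ.+ v) + s * Y (1 ℕ.+ v) + (Y (3 ℕ.+ v) + s * Y v)
        ≡⟨ regroup (Y v) (Y (1 ℕ.+ v)) (Y (2 ℕ.+ v)) (Y (3 ℕ.+ v)) s ⟩
      (Y (2 ℕ.+ v) + Y (3 ℕ.+ v)) + s * (Y v + Y (1 ℕ.+ v)) ∎
      where
      open ≡-Reasoning
      v = a ℕ.+ suc K
      identity₁ : ∀ K → (5 ℕ.+ 2 ℕ.* K) ℕ.+ (5 ℕ.+ 2 ℕ.* K) ≡ (3 ℕ.+ K) ℕ.+ ((2 ℕ.+ K) ℕ.+ (5 ℕ.+ 2 ℕ.* K))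
      identity₁ = solve-∀
      identity₂ : ∀ K → (5 ℕ.+ 2 ℕ.* K) ℕ.+ (5 ℕ.+ 2 ℕ.* K) ≡ (4 ℕ.+ K) ℕ.+ ((1 ℕ.+ K) ℕ.+ (5 ℕ.+ 2 ℕ.* K))
      identity₂ = solve-∀
      swap : ∀ a e h → a ℕ.+ (e ℕ.+ h) ≡ h ℕ.+ (a ℕ.+ e)
      swap = solve-∀
      reflected : ∀ e d → N ≡ d ℕ.+ (e ℕ.+ h) → a ℕ.+ (N ∸ d) ≡ h ℕ.+ (a ℕ.+ e)
      reflected e d N≡ = trans (cong (λ x → a ℕ.+ (x ∸ d)) N≡) (trans (cong (a ℕ.+_) (ℕ.m+n∸m≡n d (e ℕ.+ h))) (swap a e h))
      shift₁ : ∀ a K → a ℕ.+ (2 ℕ.+ K) ≡ 1 ℕ.+ (a ℕ.+ suc K)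
      shift₁ = solve-∀
      shift₂ : ∀ a K → a ℕ.+ (3 ℕ.+ K) ≡ 2 ℕ.+ (a ℕ.+ suc K)
      shift₂ = solve-∀
      shift₃ : ∀ a K → a ℕ.+ suc (3 ℕ.+ K) ≡ 3 ℕ.+ (a ℕ.+ suc K)
      shift₃ = solve-∀
      regroup : ∀ y₀ y₁ y₂ y₃ s → y₂ + s * y₁ + (y₃ + s * y₀) ≡ (y₂ + y₃) + s * (y₀ + y₁)
      regroup = ℤsolve-∀

    lowBlock : ℕ → ℤ
    lowBlock a = sum T (λ i → g a (suc i))

    rowSum-twisted : ∀ a → let v = a ℕ.+ suc K in
      rowSum Y a ≡ (lowBlock a + s * lowBlock a) + ((Y (2 ℕ.+ v) + Y (3 ℕ.+ v)) + s * (Y v + Y (1 ℕ.+ v)))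
    rowSum-twisted a = begin
      rowSum Y a
        ≡⟨ sum-χ (g a) ⟩
      W + (g a m + (g a (suc m) + sum T (λ i → g a (h ∸ T ℕ.+ i))))
        ≡⟨ cong (λ x → W + (g a m + (g a (suc m) + x))) (upper-block a) ⟩
      W + (g a m + (g a (suc m) + s * W))
        ≡⟨ regroup W (g a m) (g a (suc m)) s ⟩
      (W + s * W) + (g a m + g a (suc m))
        ≡⟨ cong (_+_ (W + s * W)) (middle a) ⟩
      (W + s * W) + ((Y (2 ℕ.+ v) + Y (3 ℕ.+ v)) + s * (Y v + Y (1 ℕ.+ v))) ∎
      where
      open ≡-Reasoning
      v : ℕ
      v = a ℕ.+ suc K
      W : ℤ
      W = lowBlock a
      regroup : ∀ w x y s → w + (x + (y + s * w)) ≡ (w + s * w) + (x + y)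
      regroup = ℤsolve-∀

    -- (9 + 3K) + (1 + K) = N, so the window of rowSum-twisted sits at v + N.
    rowSum-twisted-at : ∀ v → let a = v ℕ.+ (9 ℕ.+ 3 ℕ.* K) in
      rowSum Y a ≡ (lowBlock a + s * lowBlock a) + ((Y (2 ℕ.+ v) + Y (3 ℕ.+ v)) + s * (Y v + Y (1 ℕ.+ v)))
    rowSum-twisted-at v = trans (rowSum-twisted a) (cong₂ (λ x y → (lowBlock a + s * lowBlock a) + (x + s * y))
                                  (cong₂ _+_ (back-by-N 2) (back-by-N 3)) (cong₂ _+_ (back-by-N 0) (back-by-N 1)))
      where
      a : ℕ
      a = v ℕ.+ (9 ℕ.+ 3 ℕ.* K)
      identity : ∀ j v K → j ℕ.+ (v ℕ.+ (9 ℕ.+ 3 ℕ.* K) ℕ.+ suc K) ≡ (5 ℕ.+ 2 ℕ.* K) ℕ.+ (5 ℕ.+ 2 ℕ.* K) ℕ.+ (j ℕ.+ v)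
      identity = solve-∀
      back-by-N : ∀ j → Y (j ℕ.+ (a ℕ.+ suc K)) ≡ Y (j ℕ.+ v)
      back-by-N j = trans (cong Y (identity j v K)) (periodic (j ℕ.+ v))

module NullSpace (T K : ℕ) (T≤K : T ≤ K) where

  open import Data.Integer using (_+_; _*_; -_; _-_)
  open IntegerSums
  open Iteration
  open GeneratingSet T K T≤K

  module PeriodicPart {q : ℕ → ℤ} (per : Periodic h q) (null : ∀ a → rowSum q a ≡ 0ℤ) where

    open Twisted {s = 1ℤ} refl {Y = q} (λ x → trans (per x) (sym (ℤ.*-identityˡ (q x))))

    window : ℕ → ℤ
    window v = (q (2 ℕ.+ v) + q (3 ℕ.+ v)) + (q v + q (1 ℕ.+ v))

    2∣window : ∀ v → + 2 ∣ window v
    2∣window v = subst (+ 2 ∣_) (cong (_+_ (q (2 ℕ.+ v) + q (3 ℕ.+ v))) (ℤ.*-identityˡ (q v + q (1 ℕ.+ v))))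
                   (∣m+n∣m⇒∣n 2∣rowSum (divides X (double X)))
      where
      X : ℤ
      X = lowBlock (v ℕ.+ (9 ℕ.+ 3 ℕ.* K))
      double : ∀ x → x + 1ℤ * x ≡ x * + 2
      double = ℤsolve-∀
      2∣rowSum : + 2 ∣ (X + 1ℤ * X) + ((q (2 ℕ.+ v) + q (3 ℕ.+ v)) + 1ℤ * (q v + q (1 ℕ.+ v)))
      2∣rowSum = subst (+ 2 ∣_) (trans (sym (null (v ℕ.+ (9 ℕ.+ 3 ℕ.* K)))) (rowSum-twisted-at v)) (divides 0ℤ refl)

    flip : ∀ {x y} → + 2 ∣ x - y → + 2 ∣ y - x
    flip {x} {y} 2∣x-y = subst (+ 2 ∣_) (negate x y) (∣m⇒∣-m 2∣x-y)
      where
      negate : ∀ x y → - (x - y) ≡ y - x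
      negate = ℤsolve-∀

    2∣step4 : PeriodicMod (+ 2) 4 q
    2∣step4 v = subst (+ 2 ∣_) (telescope (q v) (q (1 ℕ.+ v)) (q (2 ℕ.+ v)) (q (3 ℕ.+ v)) (q (4 ℕ.+ v)))
                  (∣m∣n⇒∣m-n (2∣window (1 ℕ.+ v)) (2∣window v))
      where
      telescope : ∀ a b c d e → (d + e) + (b + c) - ((c + d) + (a + b)) ≡ e - a
      telescope = ℤsolve-∀

    2∣step2 : PeriodicMod (+ 2) 2 q
    2∣step2 v = flip {q v} {q (2 ℕ.+ v)} (subst (λ x → + 2 ∣ x - q (2 ℕ.+ v)) (trans (cong q (identity K v)) (periodic v))
                            (periodicMod-* {f = q} 2∣step4 (2 ℕ.+ K) (2 ℕ.+ v)))
      where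
      identity : ∀ K v → (2 ℕ.+ K) ℕ.* 4 ℕ.+ (2 ℕ.+ v) ≡ (5 ℕ.+ 2 ℕ.* K) ℕ.+ (5 ℕ.+ 2 ℕ.* K) ℕ.+ v
      identity = solve-∀

    2∣step1 : PeriodicMod (+ 2) 1 q
    2∣step1 v = flip {q v} {q (1 ℕ.+ v)} (subst (λ x → + 2 ∣ x - q (1 ℕ.+ v)) (trans (cong q (identity K v)) (per v))
                            (periodicMod-* {f = q} 2∣step2 (2 ℕ.+ K) (1 ℕ.+ v)))
      where
      identity : ∀ K v → (2 ℕ.+ K) ℕ.* 2 ℕ.+ (1 ℕ.+ v) ≡ 5 ℕ.+ 2 ℕ.* K ℕ.+ v
      identity = solve-∀

    2∣q-q₀ : ∀ x → + 2 ∣ q x - q 0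
    2∣q-q₀ x = subst (λ y → + 2 ∣ q y - q 0) (trans (ℕ.+-identityʳ (x ℕ.* 1)) (ℕ.*-identityʳ x))
                 (periodicMod-* {f = q} 2∣step1 x 0)

    sum≡0 : sum h q ≡ 0ℤ
    sum≡0 = ℤ.*-cancelʳ-≡ (sum h q) 0ℤ (+ 2) (trans (double (sum h q)) Σ+Σ≡0)
      where
      double : ∀ x → x * + 2 ≡ x + x
      double = ℤsolve-∀
      Σ+Σ≡0 : sum h q + sum h q ≡ 0ℤ
      Σ+Σ≡0 = ℤ.*-cancelˡ-≡ (+ (2 ℕ.* suc T)) (sum h q + sum h q) 0ℤ (begin
        + (2 ℕ.* suc T) * (sum h q + sum h q)      ≡⟨ sum-χ-const (sum h q + sum h q) ⟨
        sum N (λ d → χ d * (sum h q + sum h q))    ≡⟨ sum-rowSum h q per ⟨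
        sum h (rowSum q)                           ≡⟨ sum-zero h (λ a _ → null a) ⟩
        0ℤ                                         ≡⟨ ℤ.*-zeroʳ (+ (2 ℕ.* suc T)) ⟨
        + (2 ℕ.* suc T) * 0ℤ                       ∎)
        where open ≡-Reasoning

    2∣q₀ : + 2 ∣ q 0
    2∣q₀ = ∣m+n∣n⇒∣m (subst (+ 2 ∣_) (sym decomposition) (subst (+ 2 ∣_) (sym sum≡0) (divides 0ℤ refl)))
                     (∣m∣n⇒∣m+n (∣-sum h (λ x → q x - q 0) (λ x _ → 2∣q-q₀ x)) (divides (+ (2 ℕ.+ K) * q 0) refl))
      where
      D : ℤ
      D = sum h (λ x → q x - q 0)
      +h≡1+2[2+K] : + h ≡ + 1 + + (2 ℕ.+ K) * + 2
      +h≡1+2[2+K] = trans (cong +_ (identity K)) (trans (ℤ.pos-+ 1 ((2 ℕ.+ K) ℕ.* 2)) (cong (_+_ (+ 1)) (ℤ.pos-* (2 ℕ.+ K) 2)))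
        where
        identity : ∀ K → 5 ℕ.+ 2 ℕ.* K ≡ 1 ℕ.+ (2 ℕ.+ K) ℕ.* 2
        identity = solve-∀
      regroup : ∀ x k d → x + (d + k * x * + 2) ≡ d + (+ 1 + k * + 2) * x
      regroup = ℤsolve-∀
      cancel : ∀ x y → x - y + y ≡ x
      cancel = ℤsolve-∀
      decomposition : q 0 + (D + + (2 ℕ.+ K) * q 0 * + 2) ≡ sum h q
      decomposition = begin
        q 0 + (D + + (2 ℕ.+ K) * q 0 * + 2)        ≡⟨ regroup (q 0) (+ (2 ℕ.+ K)) D ⟩
        D + (+ 1 + + (2 ℕ.+ K) * + 2) * q 0        ≡⟨ cong (λ c → D + c * q 0) +h≡1+2[2+K] ⟨
        D + + h * q 0                              ≡⟨ cong (_+_ D) (sum-const h (q 0)) ⟨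
        D + sum h (λ _ → q 0)                      ≡⟨ sum-distrib-+ h (λ x → q x - q 0) (λ _ → q 0) ⟨
        sum h (λ x → q x - q 0 + q 0)              ≡⟨ sum-cong h (λ x _ → cancel (q x) (q 0)) ⟩
        sum h q                                    ∎
        where open ≡-Reasoning

    even : ∀ x → + 2 ∣ q x
    even x = subst (+ 2 ∣_) (cancel (q x) (q 0)) (∣m∣n⇒∣m+n (2∣q-q₀ x) 2∣q₀)
      where
      cancel : ∀ x y → x - y + y ≡ x
      cancel = ℤsolve-∀

  periodic-part-vanishes : ∀ {q} → Periodic h q → (∀ a → rowSum q a ≡ 0ℤ) → ∀ x → q x ≡ 0ℤ
  periodic-part-vanishes per null = infinite-descent Good (λ (per , null) → PeriodicPart.even per null) halve (per , null)
    where
    Good : (ℕ → ℤ) → Set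
    Good q = Periodic h q × (∀ a → rowSum q a ≡ 0ℤ)
    halve : ∀ {q q′} → (∀ x → q x ≡ q′ x * + 2) → Good q → Good q′
    halve {q} {q′} q≡q′*2 (per , null) = per′ , null′
      where
      per′ : Periodic h q′
      per′ x = ℤ.*-cancelʳ-≡ (q′ (h ℕ.+ x)) (q′ x) (+ 2) (trans (sym (q≡q′*2 (h ℕ.+ x))) (trans (per x) (q≡q′*2 x)))
      null′ : ∀ a → rowSum q′ a ≡ 0ℤ
      null′ a = ℤ.*-cancelʳ-≡ (rowSum q′ a) 0ℤ (+ 2) (begin
        rowSum q′ a * + 2                ≡⟨ rowSum-*ʳ q′ (+ 2) a ⟨
        rowSum (λ x → q′ x * + 2) a      ≡⟨ rowSum-cong (λ x → sym (q≡q′*2 x)) a ⟩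
        rowSum q a                       ≡⟨ null a ⟩
        0ℤ                               ∎)
        where open ≡-Reasoning

  module AntiperiodicPart {P : ℕ → ℤ} (anti : ∀ x → P (h ℕ.+ x) ≡ - P x) (null : ∀ a → rowSum P a ≡ 0ℤ) where

    open Twisted {s = -1ℤ} refl {Y = P} (λ x → trans (anti x) (sym (ℤ.-1*i≡-i (P x))))

    pair : ℕ → ℤ
    pair v = P v + P (1 ℕ.+ v)

    pair-periodic : Periodic 2 pair
    pair-periodic v = cancel (lowBlock a) (pair (2 ℕ.+ v)) (pair v) (trans (sym (rowSum-twisted-at v)) (null a))
      where
      a : ℕ
      a = v ℕ.+ (9 ℕ.+ 3 ℕ.* K)
      expand : ∀ x y z → y ≡ z + ((x + -1ℤ * x) + (y + -1ℤ * z))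
      expand = ℤsolve-∀
      cancel : ∀ x y z → (x + -1ℤ * x) + (y + -1ℤ * z) ≡ 0ℤ → y ≡ z
      cancel x y z eq = trans (expand x y z) (trans (cong (_+_ z) eq) (ℤ.+-identityʳ z))

    pair-antiperiodic : ∀ v → pair (h ℕ.+ v) ≡ - pair v
    pair-antiperiodic v = trans (cong₂ _+_ (anti v) (trans (cong P (sym (ℕ.+-suc h v))) (anti (1 ℕ.+ v))))
                                (sym (ℤ.neg-distrib-+ (P v) (P (1 ℕ.+ v))))

    pair-alternates : ∀ v → pair (1 ℕ.+ v) ≡ - pair v
    pair-alternates v = begin
      pair (1 ℕ.+ v)                          ≡⟨ periodic-* pair-periodic (2 ℕ.+ K) (1 ℕ.+ v) ⟨
      pair ((2 ℕ.+ K) ℕ.* 2 ℕ.+ (1 ℕ.+ v))    ≡⟨ cong pair (identity K v) ⟩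
      pair (h ℕ.+ v)                          ≡⟨ pair-antiperiodic v ⟩
      - pair v                                ∎
      where
      open ≡-Reasoning
      identity : ∀ K v → (2 ℕ.+ K) ℕ.* 2 ℕ.+ (1 ℕ.+ v) ≡ 5 ℕ.+ 2 ℕ.* K ℕ.+ v
      identity = solve-∀

    drift : ℕ → ℤ
    drift v = - pair v * + 2

    P-step2 : ∀ v → P (2 ℕ.+ v) ≡ P v + drift v
    P-step2 v = solve-for (P v) (P (1 ℕ.+ v)) (P (2 ℕ.+ v)) (pair-alternates v)
      where
      isolate : ∀ b c → c ≡ (b + c) - b
      isolate = ℤsolve-∀
      rearrange : ∀ a b → - (a + b) - b ≡ a + - (a + b) * + 2
      rearrange = ℤsolve-∀
      solve-for : ∀ a b c → b + c ≡ - (a + b) → c ≡ a + - (a + b) * + 2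
      solve-for a b c eq = trans (isolate b c) (trans (cong (_- b) eq) (rearrange a b))

    pair≡0 : ∀ v → pair v ≡ 0ℤ
    pair≡0 v = ℤ.*-cancelʳ-≡ (pair v) 0ℤ (+ 2) (trans (negate (pair v)) (cong -_ drift≡0))
      where
      negate : ∀ x → x * + 2 ≡ - (- x * + 2)
      negate = ℤsolve-∀
      identity : ∀ h v → h ℕ.* 2 ℕ.+ v ≡ h ℕ.+ h ℕ.+ v
      identity = solve-∀
      expand : ∀ x y → y ≡ (x + y) - x
      expand = ℤsolve-∀
      full-period : P v + + h * drift v ≡ P v
      full-period = begin
        P v + + h * drift v    ≡⟨ increment-* P drift 2 P-step2 (λ u → cong (λ x → - x * + 2) (pair-periodic u)) h v ⟨
        P (h ℕ.* 2 ℕ.+ v)      ≡⟨ cong P (identity h v) ⟩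
        P (h ℕ.+ h ℕ.+ v)      ≡⟨ periodic v ⟩
        P v                    ∎
        where open ≡-Reasoning
      h*drift≡0 : + h * drift v ≡ 0ℤ
      h*drift≡0 = trans (expand (P v) (+ h * drift v)) (trans (cong (_- P v) full-period) (ℤ.+-inverseʳ (P v)))
      drift≡0 : drift v ≡ 0ℤ
      drift≡0 = ℤ.*-cancelˡ-≡ (+ h) (drift v) 0ℤ (trans h*drift≡0 (sym (ℤ.*-zeroʳ (+ h))))

    alternates : ∀ v → P (1 ℕ.+ v) ≡ - P v
    alternates v = trans (expand (P v) (P (1 ℕ.+ v))) (trans (cong (_- P v) (pair≡0 v)) (ℤ.+-identityˡ (- P v)))
      where
      expand : ∀ x y → y ≡ (x + y) - x
      expand = ℤsolve-∀

  null-alternates : ∀ {P} → Periodic N P → (∀ a → rowSum P a ≡ 0ℤ) → ∀ x → P x ≡ -1ℤ ^ x * P 0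
  null-alternates {P} per null = alternating
    where
    p : ℕ → ℤ
    p x = P x + P (h ℕ.+ x)
    p-periodic : Periodic h p
    p-periodic x = trans (cong (_+_ (P (h ℕ.+ x))) (trans (cong P (sym (ℕ.+-assoc h h x))) (per x))) (ℤ.+-comm (P (h ℕ.+ x)) (P x))
    p-null : ∀ a → rowSum p a ≡ 0ℤ
    p-null a = begin
      rowSum p a                                   ≡⟨ rowSum-+ P (λ x → P (h ℕ.+ x)) a ⟩
      rowSum P a + rowSum (λ x → P (h ℕ.+ x)) a    ≡⟨ cong₂ _+_ (null a) (trans (rowSum-shift P h a) (null (h ℕ.+ a))) ⟩
      0ℤ                                           ∎
      where open ≡-Reasoning
    expand : ∀ x y → y ≡ (x + y) - x
    expand = ℤsolve-∀
    anti : ∀ x → P (h ℕ.+ x) ≡ - P x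
    anti x = trans (expand (P x) (P (h ℕ.+ x))) (trans (cong (_- P x) (periodic-part-vanishes p-periodic p-null x)) (ℤ.+-identityˡ (- P x)))
    open AntiperiodicPart anti null using (alternates)
    alternating : ∀ x → P x ≡ -1ℤ ^ x * P 0
    alternating zero    = sym (ℤ.*-identityˡ (P 0))
    alternating (suc x) = begin
      P (suc x)                   ≡⟨ alternates x ⟩
      - P x                       ≡⟨ cong -_ (alternating x) ⟩
      - (-1ℤ ^ x * P 0)           ≡⟨ ℤ.neg-distribˡ-* (-1ℤ ^ x) (P 0) ⟩
      - (-1ℤ ^ x) * P 0           ≡⟨ cong (_* P 0) (ℤ.-1*i≡-i (-1ℤ ^ x)) ⟨
      -1ℤ * -1ℤ ^ x * P 0         ∎
      where open ≡-Reasoning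

  -1^-antiperiodic : ∀ x → -1ℤ ^ (h ℕ.+ x) ≡ -1ℤ * -1ℤ ^ x
  -1^-antiperiodic x = trans (ℤ.^-distribˡ-+-* -1ℤ h x)
    -- (-1)^h unfolds to five factors -1 in front of (-1)^(2K).
    (cong (λ y → -1ℤ * (-1ℤ * (-1ℤ * (-1ℤ * (-1ℤ * y)))) * -1ℤ ^ x) (trans (sym (ℤ.^-*-assoc -1ℤ 2 K)) (ℤ.^-zeroˡ K)))

  module Alternating = Twisted {s = -1ℤ} refl {Y = -1ℤ ^_} -1^-antiperiodic

  -1^-null : ∀ a → rowSum (-1ℤ ^_) a ≡ 0ℤ
  -1^-null a = trans (Alternating.rowSum-twisted a) (vanish (Alternating.lowBlock a) (-1ℤ ^ (a ℕ.+ suc K)))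
    where
    vanish : ∀ x y → (x + -1ℤ * x) + ((-1ℤ * (-1ℤ * y) + -1ℤ * (-1ℤ * (-1ℤ * y))) + -1ℤ * (y + -1ℤ * y)) ≡ 0ℤ
    vanish = ℤsolve-∀

  rowSum-1 : ∀ a → rowSum (λ _ → 1ℤ) a ≡ + (4 ℕ.* suc T)
  rowSum-1 a = trans (sum-χ-const (1ℤ + 1ℤ)) (trans (sym (ℤ.pos-* (2 ℕ.* suc T) 2)) (cong +_ (identity T)))
    where
    identity : ∀ T → 2 ℕ.* suc T ℕ.* 2 ≡ 4 ℕ.* suc T
    identity = solve-∀

module NutGraph (T K : ℕ) (T≤K : T ≤ K) where

  open Rationals
  open Indicators
  open GeneratingSet T K T≤K
  open NullSpace T K T≤K

  regular : IsRegular (4 ℕ.* suc T) G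
  regular u = ℤ.+-injective (fromℤ-injective (begin
    fromℤ (+ degree G u)                         ≡⟨ degree≡∑ G u ⟩
    ∑ (λ v → adjMatrix G u v ℚ.* fromℤ 1ℤ)       ≡⟨ ∑adjMatrix≡rowSum short (λ _ → 1ℤ) (λ _ → refl) u ⟩
    fromℤ (rowSum (λ _ → 1ℤ) (toℕ u))            ≡⟨ cong fromℤ (rowSum-1 (toℕ u)) ⟩
    fromℤ (+ (4 ℕ.* suc T))                      ∎))
    where open ≡-Reasoning

  x : Vector N
  x v = fromℤ (-1ℤ ^ toℕ v)

  x-null : InNullSpace G x
  x-null u = trans (∑adjMatrix≡rowSum short (-1ℤ ^_) Alternating.periodic u) (cong fromℤ (-1^-null (toℕ u)))

  x-nonzero : NonZeroVec x
  x-nonzero = Fin.zero , λ ()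

  x-squared : ∀ i → x i ℚ.* x i ≡ 1ℚ
  x-squared i = trans (sym (fromℤ-* (-1ℤ ^ toℕ i) (-1ℤ ^ toℕ i))) (cong fromℤ (square (toℕ i)))
    where
    cancel : ∀ a → -1ℤ ℤ.* a ℤ.* (-1ℤ ℤ.* a) ≡ a ℤ.* a
    cancel = ℤsolve-∀
    square : ∀ n → -1ℤ ^ n ℤ.* -1ℤ ^ n ≡ 1ℤ
    square zero    = refl
    square (suc n) = trans (cancel (-1ℤ ^ n)) (square n)

  spanned : ∀ y → InNullSpace G y → ∃[ c ] (∀ i → y i ≡ c ℚ.* x i)
  spanned y y-null with common-denominator y
  ... | L , z , z≡ky = y Fin.zero , y≡cx
    where
    k : ℚ
    k = fromℤ +[1+ L ]
    c : ℚ
    c = y Fin.zero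
    z-null : ∀ a → rowSum (extend z) a ≡ 0ℤ
    z-null = integral-null short L z z≡ky y-null
    y≡cx : ∀ i → y i ≡ c ℚ.* x i
    y≡cx i = *-cancelˡ-≡ k (begin
      k ℚ.* y i                             ≡⟨ z≡ky i ⟨
      fromℤ (z i)                           ≡⟨ cong fromℤ (extend-toℕ z i) ⟨
      fromℤ (extend z (toℕ i))              ≡⟨ cong fromℤ (null-alternates (extend-periodic z) z-null (toℕ i)) ⟩
      fromℤ (-1ℤ ^ toℕ i ℤ.* extend z 0)    ≡⟨ fromℤ-* (-1ℤ ^ toℕ i) (extend z 0) ⟩
      x i ℚ.* fromℤ (extend z 0)            ≡⟨ cong (λ w → x i ℚ.* fromℤ w) (extend-toℕ z Fin.zero) ⟩
      x i ℚ.* fromℤ (z Fin.zero)            ≡⟨ cong (x i ℚ.*_) (z≡ky Fin.zero) ⟩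
      x i ℚ.* (k ℚ.* c)                     ≡⟨ ℚ.*-comm (x i) (k ℚ.* c) ⟩
      k ℚ.* c ℚ.* x i                       ≡⟨ ℚ.*-assoc k c (x i) ⟩
      k ℚ.* (c ℚ.* x i)                     ∎)
      where open ≡-Reasoning

  nowhere-zero : ∀ y → InNullSpace G y → NonZeroVec y → ∀ i → ¬ y i ≡ 0ℚ
  nowhere-zero y y-null (j , yj≢0) i yi≡0 = yj≢0 (begin
    y j              ≡⟨ y≡cx j ⟩
    c ℚ.* x j        ≡⟨ cong (ℚ._* x j) c≡0 ⟩
    0ℚ ℚ.* x j       ≡⟨ ℚ.*-zeroˡ (x j) ⟩
    0ℚ               ∎)
    where
    open ≡-Reasoning
    c : ℚ
    c = proj₁ (spanned y y-null)
    y≡cx : ∀ i → y i ≡ c ℚ.* x i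
    y≡cx = proj₂ (spanned y y-null)
    c≡0 : c ≡ 0ℚ
    c≡0 = begin
      c                      ≡⟨ ℚ.*-identityʳ c ⟨
      c ℚ.* 1ℚ               ≡⟨ cong (c ℚ.*_) (x-squared i) ⟨
      c ℚ.* (x i ℚ.* x i)    ≡⟨ ℚ.*-assoc c (x i) (x i) ⟨
      c ℚ.* x i ℚ.* x i      ≡⟨ cong (ℚ._* x i) (trans (sym (y≡cx i)) yi≡0) ⟩
      0ℚ ℚ.* x i             ≡⟨ ℚ.*-zeroˡ (x i) ⟩
      0ℚ                     ∎

  regular-nut : IsRegular (4 ℕ.* suc T) G × IsNut G
  regular-nut = regular , s≤s (s≤s z≤n) , (x , x-null , x-nonzero , spanned) , nowhere-zero

order-decomposition : ∀ T n → 4 ℕ.* suc T ℕ.+ 6 ≤ n → n % 4 ≡ 2 →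
  ∃[ K ] (T ≤ K × n ≡ (5 ℕ.+ 2 ℕ.* K) ℕ.+ (5 ℕ.+ 2 ℕ.* K))
order-decomposition T n bound n%4≡2 = K , T≤K , n≡h+h
  where
  A K : ℕ
  A = n / 4
  K = A ∸ 2
  lower : ∀ T → 4 ℕ.* suc T ℕ.+ 6 ≡ 2 ℕ.+ (T ℕ.+ 2) ℕ.* 4
  lower = solve-∀
  halves : ∀ K → 2 ℕ.+ (K ℕ.+ 2) ℕ.* 4 ≡ (5 ℕ.+ 2 ℕ.* K) ℕ.+ (5 ℕ.+ 2 ℕ.* K)
  halves = solve-∀
  n≡2+A*4 : n ≡ 2 ℕ.+ A ℕ.* 4
  n≡2+A*4 = trans (m≡m%n+[m/n]*n n 4) (cong (ℕ._+ A ℕ.* 4) n%4≡2)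
  T+2≤A : T ℕ.+ 2 ≤ A
  T+2≤A = ℕ.*-cancelʳ-≤ (T ℕ.+ 2) A 4 (ℕ.+-cancelˡ-≤ 2 _ _ (subst₂ _≤_ (lower T) n≡2+A*4 bound))
  K+2≡A : K ℕ.+ 2 ≡ A
  K+2≡A = ℕ.m∸n+n≡m (ℕ.≤-trans (ℕ.m≤n+m 2 T) T+2≤A)
  T≤K : T ≤ K
  T≤K = ℕ.+-cancelʳ-≤ 2 T K (subst (T ℕ.+ 2 ≤_) (sym K+2≡A) T+2≤A)
  n≡h+h : n ≡ (5 ℕ.+ 2 ℕ.* K) ℕ.+ (5 ℕ.+ 2 ℕ.* K)
  n≡h+h = trans n≡2+A*4 (trans (cong (λ a → 2 ℕ.+ a ℕ.* 4) (sym K+2≡A)) (halves K))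

open import Data.Nat using (_+_; _*_)

theorem12 : (t n : ℕ) → 1 ≤ t → 4 * t + 6 ≤ n → n % 4 ≡ 2 →
    .{{_ : NonZero n}} →
    IsRegular (4 * t) (Circ n (S'' t n) (S''? t n)) × IsNut (Circ n (S'' t n) (S''? t n))
theorem12 (suc T) n _ bound n%4≡2 with order-decomposition T n bound n%4≡2
... | K , T≤K , refl = NutGraph.regular-nut T K T≤K
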